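{- Let $A\subset\mathbb{P}$ be an infinite set of primes, with elements listed in increasing order $p_{1;A}<p_{2;A}<\cdots$. Let $N\ge1$ and $A_N=\{p_{1;A},\dots,p_{N;A}\}$. Then for every integer $k\ge2$, $$\sum^{'(k)}_{n:\ p\mid n\Rightarrow p\in A_N}\frac1{n_{\{(k-1)\text{ -free}\}}\,\phi\big(n_{\{(k-1)\text{ -power}\}}\big)}=\sum_{n:\ p\mid n\Rightarrow p\in A_N}\frac1n,$$ where $\phi$ is Euler's totient function.
   Context: $\mathbb{P}$ denotes the set of primes; sums are over positive integers $n$ all of whose prime divisors lie in $A_N$ (including $n=1$). For $k\ge2$, $n$ is $k$-free if $p^k\nmid n$ for every prime $p$, and $\sum^{'(k)}$ denotes the sum restricted to $k$-free integers. For $m\ge2$, every $n\in\mathbb{N}$ can be written uniquely as $n=n_{\{m\text{ -free}\}}\,n_{\{m\text{ -power}\}}$ where $n_{\{m\text{ -free}\}}$ is $m$-free and $n_{\{m\text{ -power}\}}$ is an $m$-th power of a positive integer; for $m=1$ one sets $n_{\{1\text{ -free}\}}=1$ and $n_{\{1\text{ -power}\}}=n$. -}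

module Defs where

open import Data.Nat using (ℕ; zero; suc; _*_; _^_; _∸_; _≤_; _≟_; s≤s; z≤n; NonZero)
open import Data.Nat.Properties using (allUpTo?; anyUpTo?; ≤-<-trans; n<1+n; ≰⇒>)
open import Data.Nat.Divisibility using (_∣_; _∣?_; ∣-trans; ∣⇒≤; _∣0; 1∣_; n∣m*n; m∣m*n; ∣1⇒≡1)
open import Data.Nat.Primality using (Prime; prime?)
open import Data.Nat.Coprimality using (coprime?)
open import Data.Integer using (+_)
open import Data.Rational using (ℚ; 0ℚ; _+_; _-_; _<_; ∣_∣) renaming (_/_ to _÷_)
open import Data.List using (List; []; _∷_; map; upTo; filter; length; concatMap)
open import Data.Product using (_×_; _,_; ∃-syntax; proj₁; proj₂)
open import Relation.Nullary using (Dec; yes; no; ¬_; ¬?)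
open import Relation.Nullary.Decidable using (from-yes; _×-dec_; _→-dec_; map′)
open import Relation.Binary.PropositionalEquality using (_≡_; refl)
open import Data.Empty using (⊥-elim)

-- A_N-smoothness: every prime divisor of n lies in A_N = {p 0, …, p (N-1)},
-- where p : ℕ → ℕ enumerates A increasingly (p i = p_{i+1;A}).
Smooth : (ℕ → ℕ) → ℕ → ℕ → Set
Smooth p N n = ∀ q → Prime q → q ∣ n → ∃[ i ] (i Data.Nat.< N × q ≡ p i)

Free : ℕ → ℕ → Set
Free k n = ∀ q → Prime q → ¬ (q ^ k ∣ n)

range1 : ℕ → List ℕ
range1 n = map suc (upTo n)

φ : ℕ → ℕ
φ n = length (filter (λ i → coprime? i n) (range1 n))

private
  2-prime : Prime 2
  2-prime = from-yes (prime? 2)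

  p∣p^sm : ∀ q m → q ∣ q ^ suc m
  p∣p^sm q m = m∣m*n (q ^ m)

free? : ∀ m a → Dec (Free m a)
free? zero a = no (λ f → f 2 2-prime (1∣ a))
free? (suc m) zero = no (λ f → f 2 2-prime (_ ∣0))
free? (suc m) (suc a) = map′ to from (allUpTo? (λ q → prime? q →-dec ¬? (q ^ suc m ∣? suc a)) (suc (suc a)))
  where
  to : (∀ {q} → q Data.Nat.< suc (suc a) → Prime q → ¬ (q ^ suc m ∣ suc a)) → Free (suc m) (suc a)
  to h q pq d = h (s≤s (∣⇒≤ (∣-trans (p∣p^sm q m) d))) pq d
  from : Free (suc m) (suc a) → ∀ {q} → q Data.Nat.< suc (suc a) → Prime q → ¬ (q ^ suc m ∣ suc a)
  from f {q} _ = f q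

smooth? : ∀ p N n → Dec (Smooth p N (suc n))
smooth? p N n = map′ to from (allUpTo? (λ q → prime? q →-dec (q ∣? suc n →-dec anyUpTo? (λ i → q ≟ p i) N)) (suc (suc n)))
  where
  to : (∀ {q} → q Data.Nat.< suc (suc n) → Prime q → q ∣ suc n → ∃[ i ] (i Data.Nat.< N × q ≡ p i)) → Smooth p N (suc n)
  to h q pq d = h (s≤s (∣⇒≤ d)) pq d
  from : Smooth p N (suc n) → ∀ {q} → q Data.Nat.< suc (suc n) → Prime q → q ∣ suc n → ∃[ i ] (i Data.Nat.< N × q ≡ p i)
  from f {q} _ = f q

-- For m ≥ 2: the (unique) pair (a , b^m) with
-- a * b^m ≡ n and a m-free, found by exhaustive search over
-- 1 ≤ a, b ≤ n (returns (n , 1) in the impossible no-witness case).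
-- decomp m n returns (n_{m-free} , n_{m-power}).

IsDecomp : ℕ → ℕ → ℕ × ℕ → Set
IsDecomp m n (a , b) = a * b ^ m ≡ n × Free m a

isDecomp? : ∀ m n ab → Dec (IsDecomp m n ab)
isDecomp? m n (a , b) = (a * b ^ m ≟ n) ×-dec free? m a

pairs : ℕ → List (ℕ × ℕ)
pairs n = concatMap (λ a → map (a ,_) (range1 n)) (range1 n)

decomp : ℕ → ℕ → ℕ × ℕ
decomp zero n = (n , 1)
decomp (suc zero) n = (1 , n)
decomp m@(suc (suc _)) n with filter (isDecomp? m n) (pairs n)
... | [] = (n , 1)
... | (a , b) ∷ _ = (a , b ^ m)

freePart : ℕ → ℕ → ℕ
freePart m n = proj₁ (decomp m n)

powerPart : ℕ → ℕ → ℕ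
powerPart m n = proj₂ (decomp m n)

-- 1/d as a rational (d = 0 ↦ 0, never used with d = 0 below).
inv : ℕ → ℚ
inv zero = 0ℚ
inv (suc d) = (+ 1) ÷ suc d

sumTo : (ℕ → ℚ) → ℕ → ℚ
sumTo f zero = 0ℚ
sumTo f (suc M) = sumTo f M + f (suc M)

ConvergesTo : (ℕ → ℚ) → ℚ → Set
ConvergesTo s L = ∀ ε → 0ℚ < ε → ∃[ M ] (∀ M' → M ≤ M' → ∣ s M' - L ∣ < ε)

-- Partial sums (n ≤ M) of the left-hand series: n ranges over k-free,
-- A_N-smooth positive integers.
lhsTerm : (ℕ → ℕ) → ℕ → ℕ → ℕ → ℚ
lhsTerm p N k zero = 0ℚ
lhsTerm p N k (suc n) with free? k (suc n) | smooth? p N n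
... | yes _ | yes _ = inv (freePart (k ∸ 1) (suc n) * φ (powerPart (k ∸ 1) (suc n)))
... | _ | _ = 0ℚ

lhsPartial : (ℕ → ℕ) → ℕ → ℕ → ℕ → ℚ
lhsPartial p N k = sumTo (lhsTerm p N k)

rhsTerm : (ℕ → ℕ) → ℕ → ℕ → ℚ
rhsTerm p N zero = 0ℚ
rhsTerm p N (suc n) with smooth? p N n
... | yes _ = inv (suc n)
... | no _ = 0ℚ

rhsPartial : (ℕ → ℕ) → ℕ → ℕ → ℚ
rhsPartial p N = sumTo (rhsTerm p N)

module Submission where

-- Write z p = p / (p - 1) = Σ_e p ^ -e.  The A_N-smooth numbers are exactly the products
-- ∏ p_j ^ e_j over the first N primes of A, with a unique exponent vector, so the sum of a
-- multiplicative weight over a box of exponent vectors is the product of one-dimensional sums.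
-- A smooth n is k-free iff every e_j ≤ k - 1.  A prime power p ^ e with e < k - 1 contributes
-- p ^ -e to 1 / (n_{(k-1)-free} φ(n_{(k-1)-power})), while p ^ (k-1) is a (k-1)-th power and
-- contributes 1 / (p ^ (k-2) (p - 1)) = p ^ -(k-1) z p; these add up to z p, so the left series
-- is a finite sum equal to ∏ z p_j.  The partial sums of Σ 1/n are squeezed between the box sums
-- ∏ z p_j (1 - p_j ^ -E) and ∏ z p_j, whose difference is at most N ∏ p_j / 2 ^ E.

open import Data.Nat as ℕ using (ℕ; suc)
open import Data.Nat.Primality using (Prime)

module Arithmetic where

  open import Data.Nat
  open import Data.Nat.Properties
  open import Data.Nat.Divisibility
  open import Data.Nat.Primality
  open import Data.Nat.Primality.Factorisation using (factorise)
  open import Data.Nat.Coprimality using (Coprime; coprime-divisor)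
  open import Data.Nat.ListAction using (product)
  open import Data.List using ([]; _∷_)
  open import Data.List.Relation.Unary.All using (_∷_)
  open import Data.Product using (_×_; _,_; ∃-syntax)
  open import Data.Sum using (inj₁; inj₂)
  open import Data.Empty using (⊥; ⊥-elim)
  open import Relation.Nullary using (¬_; yes; no)
  open import Relation.Binary.PropositionalEquality
  open import Data.Nat.Solver using (module +-*-Solver)
  open +-*-Solver using (solve; _:*_; _:=_)

  prime⇒2≤ : ∀ {q} → Prime q → 2 ≤ q
  prime⇒2≤ {q} pq = nonTrivial⇒n>1 q {{prime⇒nonTrivial pq}}

  prime⇒≢1 : ∀ {q} → Prime q → q ≢ 1
  prime⇒≢1 pq = nonTrivial⇒≢1 {{prime⇒nonTrivial pq}}

  prime∣prime⇒≡ : ∀ {r q} → Prime r → Prime q → r ∣ q → r ≡ q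
  prime∣prime⇒≡ pr pq r∣q with prime⇒irreducible pq r∣q
  ... | inj₁ r≡1 = ⊥-elim (prime⇒≢1 pr r≡1)
  ... | inj₂ r≡q = r≡q

  prime∣^⇒∣ : ∀ {r m} e → Prime r → r ∣ m ^ e → r ∣ m
  prime∣^⇒∣ zero pr r∣1 = ⊥-elim (prime⇒≢1 pr (∣1⇒≡1 r∣1))
  prime∣^⇒∣ {m = m} (suc e) pr r∣m^1+e with euclidsLemma m (m ^ e) pr r∣m^1+e
  ... | inj₁ r∣m = r∣m
  ... | inj₂ r∣m^e = prime∣^⇒∣ e pr r∣m^e

  prime∣prime^⇒≡ : ∀ {r q} e → Prime r → Prime q → r ∣ q ^ e → r ≡ q
  prime∣prime^⇒≡ e pr pq r∣q^e = prime∣prime⇒≡ pr pq (prime∣^⇒∣ e pr r∣q^e)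

  ∃primeDivisor : ∀ n → 2 ≤ n → ∃[ s ] (Prime s × s ∣ n)
  ∃primeDivisor n@(suc _) 2≤n with factorise n
  ... | record { factors = [] ; isFactorisation = refl } = ⊥-elim (<-irrefl refl 2≤n)
  ... | record { factors = s ∷ fs ; isFactorisation = n≡Πfs ; factorsPrime = ps ∷ _ } =
    s , ps , subst (s ∣_) (sym n≡Πfs) (m∣m*n (product fs))

  noCommonPrime⇒coprime : ∀ a b → (∀ s → Prime s → s ∣ a → s ∣ b → ⊥) → Coprime a b
  noCommonPrime⇒coprime a b h {zero} (0∣a , 0∣b) with refl ← 0∣⇒≡0 0∣a | refl ← 0∣⇒≡0 0∣b =
    ⊥-elim (h 2 prime[2] (2 ∣0) (2 ∣0))
  noCommonPrime⇒coprime a b h {1} _ = refl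
  noCommonPrime⇒coprime a b h {d@(suc (suc _))} (d∣a , d∣b) with ∃primeDivisor d (s≤s (s≤s z≤n))
  ... | s , ps , s∣d = ⊥-elim (h s ps (∣-trans s∣d d∣a) (∣-trans s∣d d∣b))

  coprime-* : ∀ {i a b} → Coprime i a → Coprime i b → Coprime i (a * b)
  coprime-* {i} {a} {b} i⊥a i⊥b {d} (d∣i , d∣ab) = i⊥b (d∣i , coprime-divisor d⊥a d∣ab)
    where
    d⊥a : Coprime d a
    d⊥a (e∣d , e∣a) = i⊥a (∣-trans e∣d d∣i , e∣a)

  coprime-∣ʳ : ∀ {i m n} → Coprime i n → m ∣ n → Coprime i m
  coprime-∣ʳ i⊥n m∣n (d∣i , d∣m) = i⊥n (d∣i , ∣-trans d∣m m∣n)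

  prime∤⇒coprime : ∀ {q n} → Prime q → ¬ (q ∣ n) → Coprime q n
  prime∤⇒coprime pq q∤n (d∣q , d∣n) with prime⇒irreducible pq d∣q
  ... | inj₁ d≡1 = d≡1
  ... | inj₂ refl = ⊥-elim (q∤n d∣n)

  ^-distribʳ-* : ∀ a b m → (a * b) ^ m ≡ a ^ m * b ^ m
  ^-distribʳ-* a b zero = refl
  ^-distribʳ-* a b (suc m) = begin
    a * b * (a * b) ^ m       ≡⟨ cong (a * b *_) (^-distribʳ-* a b m) ⟩
    a * b * (a ^ m * b ^ m)   ≡⟨ solve 4 (λ a b x y → a :* b :* (x :* y) := a :* x :* (b :* y)) refl a b (a ^ m) (b ^ m) ⟩
    a * a ^ m * (b * b ^ m)   ∎
    where open ≡-Reasoning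

  ∣⇒^∣^ : ∀ {d n} e → d ∣ n → d ^ e ∣ n ^ e
  ∣⇒^∣^ zero _ = ∣-refl
  ∣⇒^∣^ (suc e) d∣n = *-pres-∣ d∣n (∣⇒^∣^ e d∣n)

  ^*-unique : ∀ {q} .{{_ : NonZero q}} → ∀ e e' m m' → ¬ (q ∣ m) → ¬ (q ∣ m') → q ^ e * m ≡ q ^ e' * m' → e ≡ e' × m ≡ m'
  ^*-unique zero zero m m' _ _ eq = refl , trans (sym (*-identityˡ m)) (trans eq (*-identityˡ m'))
  ^*-unique {q} (suc e) zero m m' _ q∤m' eq =
    ⊥-elim (q∤m' (divides (q ^ e * m) (trans (sym (trans eq (*-identityˡ m'))) (trans (*-assoc q (q ^ e) m) (*-comm q (q ^ e * m))))))
  ^*-unique zero (suc e') m m' q∤m q∤m' eq with ^*-unique (suc e') zero m' m q∤m' q∤m (sym eq)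
  ... | () , _
  ^*-unique {q} (suc e) (suc e') m m' q∤m q∤m' eq
    with ^*-unique e e' m m' q∤m q∤m'
           (*-cancelˡ-≡ (q ^ e * m) (q ^ e' * m') q (trans (sym (*-assoc q (q ^ e) m)) (trans eq (*-assoc q (q ^ e') m'))))
  ... | refl , m≡m' = refl , m≡m'

  factorOut : ∀ q → 2 ≤ q → ∀ n → 0 < n → ∃[ e ] ∃[ m ] (n ≡ q ^ e * m × ¬ (q ∣ m))
  factorOut q q≥2 n 0<n = go n n ≤-refl 0<n
    where
    go : ∀ fuel n → n ≤ fuel → 0 < n → ∃[ e ] ∃[ m ] (n ≡ q ^ e * m × ¬ (q ∣ m))
    go zero n n≤0 0<n = ⊥-elim (<⇒≱ 0<n n≤0)
    go (suc fuel) n n≤1+fuel 0<n with q ∣? n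
    ... | no q∤n = 0 , n , sym (*-identityˡ n) , q∤n
    ... | yes (divides c n≡c*q) with go fuel c c≤fuel 0<c
      where
      0<c : 0 < c
      0<c = n≢0⇒n>0 (λ c≡0 → <⇒≢ 0<n (sym (trans n≡c*q (cong (_* q) c≡0))))
      c≤fuel : c ≤ fuel
      c≤fuel = ≤-pred (≤-trans (subst (c <_) (sym n≡c*q) (m<m*n c q {{>-nonZero 0<c}} q≥2)) n≤1+fuel)
    ... | e , m , c≡q^e*m , q∤m = suc e , m , n≡q^1+e*m , q∤m
      where
      n≡q^1+e*m : n ≡ q ^ suc e * m
      n≡q^1+e*m = trans n≡c*q (trans (cong (_* q) c≡q^e*m) (solve 3 (λ q x m → x :* m :* q := q :* x :* m) refl q (q ^ e) m))

  n<2^n : ∀ n → n < 2 ^ n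
  n<2^n zero = s≤s z≤n
  n<2^n (suc n) = +-mono-≤ {1} {2 ^ n} (m^n>0 2 n) (subst (suc n ≤_) (sym (+-identityʳ (2 ^ n))) (n<2^n n))

module ExponentVectors (p : ℕ → ℕ) (p-prime : ∀ i → Prime (p i)) (p-increasing : ∀ i → p i ℕ.< p (suc i)) where

  open Arithmetic
  open import Defs using (Smooth; Free)
  open import Data.Nat
  open import Data.Nat.Properties
  open import Data.Nat.Divisibility
  open import Data.Nat.Primality
  open import Data.Nat.Coprimality using (Coprime; coprime-divisor)
  open import Data.Vec using (Vec; []; _∷_)
  open import Data.Vec.Relation.Unary.All using (All; []; _∷_)
  open import Data.Product using (_,_; ∃-syntax)
  open import Data.Sum using (inj₁; inj₂)
  open import Data.Empty using (⊥-elim)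
  open import Relation.Nullary using (¬_; yes; no)
  open import Relation.Binary using (tri<; tri≈; tri>)
  open import Relation.Binary.PropositionalEquality

  p-mono-< : ∀ {i j} → i < j → p i < p j
  p-mono-< {i} {suc j} (s≤s i≤j) with m≤n⇒m<n∨m≡n i≤j
  ... | inj₁ i<j = <-trans (p-mono-< i<j) (p-increasing j)
  ... | inj₂ refl = p-increasing i

  p-injective : ∀ {i j} → p i ≡ p j → i ≡ j
  p-injective {i} {j} pi≡pj with <-cmp i j
  ... | tri< i<j _ _ = ⊥-elim (<⇒≢ (p-mono-< i<j) pi≡pj)
  ... | tri≈ _ i≡j _ = i≡j
  ... | tri> _ _ j<i = ⊥-elim (<⇒≢ (p-mono-< j<i) (sym pi≡pj))

  instance
    p-nonZero : ∀ {i} → NonZero (p i)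
    p-nonZero {i} = prime⇒nonZero (p-prime i)

    p∸1-nonZero : ∀ {i} → NonZero (p i ∸ 1)
    p∸1-nonZero {i} = >-nonZero (∸-monoˡ-≤ 1 (prime⇒2≤ (p-prime i)))

  -- The head of a vector of length j + 1 is the exponent of the largest prime p j.
  ⟦_⟧ : ∀ {j} → Vec ℕ j → ℕ
  ⟦ [] ⟧ = 1
  ⟦_⟧ {suc j} (e ∷ v) = p j ^ e * ⟦ v ⟧

  ⟦⟧-nonZero : ∀ {j} (v : Vec ℕ j) → NonZero ⟦ v ⟧
  ⟦⟧-nonZero [] = _
  ⟦⟧-nonZero {suc j} (e ∷ v) = m*n≢0 (p j ^ e) ⟦ v ⟧ {{m^n≢0 (p j) e}} {{⟦⟧-nonZero v}}

  ⟦⟧-smooth : ∀ {j} (v : Vec ℕ j) → Smooth p j ⟦ v ⟧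
  ⟦⟧-smooth [] r pr r∣1 = ⊥-elim (prime⇒≢1 pr (∣1⇒≡1 r∣1))
  ⟦⟧-smooth {suc j} (e ∷ v) r pr r∣⟦e∷v⟧ with euclidsLemma (p j ^ e) ⟦ v ⟧ pr r∣⟦e∷v⟧
  ... | inj₁ r∣pj^e = j , ≤-refl , prime∣prime^⇒≡ e pr (p-prime j) r∣pj^e
  ... | inj₂ r∣⟦v⟧ with ⟦⟧-smooth v r pr r∣⟦v⟧
  ... | i , i<j , r≡pi = i , m≤n⇒m≤1+n i<j , r≡pi

  p∤⟦⟧ : ∀ {j} (v : Vec ℕ j) → ¬ (p j ∣ ⟦ v ⟧)
  p∤⟦⟧ {j} v pj∣⟦v⟧ with ⟦⟧-smooth v (p j) (p-prime j) pj∣⟦v⟧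
  ... | i , i<j , pj≡pi = <⇒≢ i<j (sym (p-injective pj≡pi))

  ⟦⟧-injective : ∀ {j} (u v : Vec ℕ j) → ⟦ u ⟧ ≡ ⟦ v ⟧ → u ≡ v
  ⟦⟧-injective [] [] _ = refl
  ⟦⟧-injective {suc j} (e ∷ u) (e' ∷ v) eq
    with ^*-unique e e' ⟦ u ⟧ ⟦ v ⟧ (p∤⟦⟧ u) (p∤⟦⟧ v) eq
  ... | refl , ⟦u⟧≡⟦v⟧ = cong (e ∷_) (⟦⟧-injective u v ⟦u⟧≡⟦v⟧)

  smooth⇒∃⟦⟧ : ∀ j n → 0 < n → Smooth p j n → ∃[ v ] (⟦_⟧ {j} v ≡ n)
  smooth⇒∃⟦⟧ zero 1 _ _ = [] , refl
  smooth⇒∃⟦⟧ zero n@(suc (suc _)) _ n-smooth with ∃primeDivisor n (s≤s (s≤s z≤n))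
  ... | s , ps , s∣n with n-smooth s ps s∣n
  ... | _ , () , _
  smooth⇒∃⟦⟧ (suc j) n 0<n n-smooth with factorOut (p j) (prime⇒2≤ (p-prime j)) n 0<n
  ... | e , m , n≡pj^e*m , pj∤m with smooth⇒∃⟦⟧ j m 0<m m-smooth
    where
    0<m : 0 < m
    0<m = n≢0⇒n>0 (λ m≡0 → <⇒≢ 0<n (sym (trans n≡pj^e*m (trans (cong (p j ^ e *_) m≡0) (*-zeroʳ (p j ^ e))))))
    m-smooth : Smooth p j m
    m-smooth r pr r∣m with n-smooth r pr (∣-trans r∣m (divides (p j ^ e) n≡pj^e*m))
    ... | i , i<1+j , refl with m≤n⇒m<n∨m≡n (≤-pred i<1+j)
    ... | inj₁ i<j = i , i<j , refl
    ... | inj₂ refl = ⊥-elim (pj∤m r∣m)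
  ... | v , ⟦v⟧≡m = (e ∷ v) , trans (cong (p j ^ e *_) ⟦v⟧≡m) (sym n≡pj^e*m)

  exponents<⇒free : ∀ K {j} (v : Vec ℕ j) → All (_< suc K) v → Free (suc K) ⟦ v ⟧
  exponents<⇒free K [] [] r pr r^K∣1 = prime⇒≢1 pr (∣1⇒≡1 (∣-trans (m∣m*n (r ^ K)) r^K∣1))
  exponents<⇒free K {suc j} (e ∷ v) (e<1+K ∷ v<) r pr r^1+K∣ with r ≟ p j
  ... | yes refl = p∤⟦⟧ v (∣-trans (m∣m*n (p j ^ d)) (*-cancelˡ-∣ (p j ^ e) {{m^n≢0 (p j) e}} pj^e*pj^1+d∣))
    where
    d : ℕ
    d = K ∸ e
    1+K≡e+1+d : suc K ≡ e + suc d
    1+K≡e+1+d = trans (cong suc (sym (m+[n∸m]≡n (≤-pred e<1+K)))) (sym (+-suc e d))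
    pj^e*pj^1+d∣ : p j ^ e * p j ^ suc d ∣ p j ^ e * ⟦ v ⟧
    pj^e*pj^1+d∣ = subst (_∣ p j ^ e * ⟦ v ⟧) (trans (cong (p j ^_) 1+K≡e+1+d) (^-distribˡ-+-* (p j) e (suc d))) r^1+K∣
  ... | no r≢pj = exponents<⇒free K v v< r pr (coprime-divisor r^1+K⊥pj^e r^1+K∣)
    where
    r^1+K⊥pj^e : Coprime (r ^ suc K) (p j ^ e)
    r^1+K⊥pj^e = noCommonPrime⇒coprime (r ^ suc K) (p j ^ e) λ s ps s∣r^1+K s∣pj^e →
      r≢pj (trans (sym (prime∣prime^⇒≡ (suc K) ps pr s∣r^1+K)) (prime∣prime^⇒≡ e ps (p-prime j) s∣pj^e))

  free⇒exponents< : ∀ K {j} (v : Vec ℕ j) → Free K ⟦ v ⟧ → All (_< K) v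
  free⇒exponents< K [] _ = []
  free⇒exponents< K {suc j} (e ∷ v) free with K ≤? e
  ... | yes K≤e = ⊥-elim (free (p j) (p-prime j) (∣-trans pj^K∣pj^e (m∣m*n ⟦ v ⟧)))
    where
    pj^K∣pj^e : p j ^ K ∣ p j ^ e
    pj^K∣pj^e = divides (p j ^ (e ∸ K)) (trans (cong (p j ^_) (sym (m+[n∸m]≡n K≤e)))
                  (trans (^-distribˡ-+-* (p j) K (e ∸ K)) (*-comm (p j ^ K) _)))
  ... | no K≰e = ≰⇒> K≰e ∷ free⇒exponents< K v (λ r pr r^K∣⟦v⟧ → free r pr (∣-trans r^K∣⟦v⟧ (n∣m*n (p j ^ e))))

  ⟦⟧≤⇒exponents< : ∀ M {j} (v : Vec ℕ j) → ⟦ v ⟧ ≤ M → All (_< M) v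
  ⟦⟧≤⇒exponents< M [] _ = []
  ⟦⟧≤⇒exponents< M {suc j} (e ∷ v) ⟦e∷v⟧≤M = e<M ∷ ⟦⟧≤⇒exponents< M v (≤-trans (m≤n*m ⟦ v ⟧ (p j ^ e) {{m^n≢0 (p j) e}}) ⟦e∷v⟧≤M)
    where
    e<M : e < M
    e<M = begin-strict
      e                <⟨ n<2^n e ⟩
      2 ^ e            ≤⟨ ^-monoˡ-≤ e (prime⇒2≤ (p-prime j)) ⟩
      p j ^ e          ≤⟨ m≤m*n (p j ^ e) ⟦ v ⟧ {{⟦⟧-nonZero v}} ⟩
      p j ^ e * ⟦ v ⟧  ≤⟨ ⟦e∷v⟧≤M ⟩
      M                ∎
      where open ≤-Reasoning

module RangeLists where

  open import Defs using (range1)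
  open import Data.Nat
  open import Data.Nat.Properties using (suc-injective; +-identityʳ; +-suc)
  open import Data.List using (map; upTo; _++_; [_])
  open import Data.List.Properties using (map-++; upTo-∷ʳ; ++-assoc; ++-identityʳ)
  open import Data.List.Membership.Propositional using (_∈_)
  open import Data.List.Membership.Propositional.Properties using (∈-map⁺; ∈-map⁻; ∈-upTo⁺; ∈-upTo⁻)
  open import Data.List.Relation.Unary.Unique.Propositional using (Unique)
  open import Data.List.Relation.Unary.Unique.Propositional.Properties using (map⁺; upTo⁺)
  open import Data.Product using (_×_; _,_)
  open import Relation.Binary.PropositionalEquality hiding ([_])

  range1⁺ : ∀ {x n} → 0 < x → x ≤ n → x ∈ range1 n
  range1⁺ {suc x} _ x≤n = ∈-map⁺ suc (∈-upTo⁺ x≤n)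

  range1⁻ : ∀ {x n} → x ∈ range1 n → 0 < x × x ≤ n
  range1⁻ x∈ with ∈-map⁻ suc x∈
  ... | _ , y∈ , refl = s≤s z≤n , ∈-upTo⁻ y∈

  range1-unique : ∀ n → Unique (range1 n)
  range1-unique n = map⁺ suc-injective (upTo⁺ n)

  range1-suc : ∀ n → range1 (suc n) ≡ range1 n ++ [ suc n ]
  range1-suc n = trans (cong (map suc) (sym (upTo-∷ʳ n))) (map-++ suc (upTo n) [ n ])

  range1-+ : ∀ a b → range1 (a + b) ≡ range1 a ++ map (a +_) (range1 b)
  range1-+ a zero = trans (cong range1 (+-identityʳ a)) (sym (++-identityʳ (range1 a)))
  range1-+ a (suc b) = begin
    range1 (a + suc b)                                    ≡⟨ cong range1 (+-suc a b) ⟩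
    range1 (suc (a + b))                                  ≡⟨ range1-suc (a + b) ⟩
    range1 (a + b) ++ [ suc (a + b) ]                     ≡⟨ cong₂ _++_ (range1-+ a b) (cong [_] (sym (+-suc a b))) ⟩
    (range1 a ++ map (a +_) (range1 b)) ++ [ a + suc b ]  ≡⟨ ++-assoc (range1 a) _ _ ⟩
    range1 a ++ (map (a +_) (range1 b) ++ [ a + suc b ])  ≡⟨ cong (range1 a ++_) (sym (map-++ (a +_) (range1 b) [ suc b ])) ⟩
    range1 a ++ map (a +_) (range1 b ++ [ suc b ])        ≡⟨ cong (λ xs → range1 a ++ map (a +_) xs) (sym (range1-suc b)) ⟩
    range1 a ++ map (a +_) (range1 (suc b))               ∎
    where open ≡-Reasoning

module FreePowerDecomposition where

  open Arithmetic
  open RangeLists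
  open import Defs using (Free; decomp; isDecomp?; pairs; range1)
  open import Data.Nat
  open import Data.Nat.Properties
  open import Data.Nat.Divisibility
  open import Data.Nat.Primality
  open import Data.Nat.Coprimality using (Coprime; coprime-divisor)
  open import Data.List using ([]; _∷_; map; filter)
  open import Data.List.Membership.Propositional using (_∈_)
  open import Data.List.Membership.Propositional.Properties
  open import Data.List.Relation.Unary.Any using (here)
  open import Data.Product using (_×_; _,_; proj₁)
  open import Data.Empty using (⊥-elim)
  open import Relation.Nullary using (yes; no; contradiction)
  open import Relation.Binary.PropositionalEquality

  free⇒>0 : ∀ m a → Free (suc m) a → 0 < a
  free⇒>0 m zero free = ⊥-elim (free 2 prime[2] (_ ∣0))
  free⇒>0 m (suc a) _ = s≤s z≤n

  free[1]⇒≡1 : ∀ a → Free 1 a → a ≡ 1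
  free[1]⇒≡1 zero free = ⊥-elim (free 2 prime[2] (_ ∣0))
  free[1]⇒≡1 1 _ = refl
  free[1]⇒≡1 a@(suc (suc _)) free with ∃primeDivisor a (s≤s (s≤s z≤n))
  ... | s , ps , s∣a = ⊥-elim (free s ps (subst (_∣ a) (sym (*-identityʳ s)) s∣a))

  -- s ^ M divides a * b ^ M; were s ∤ b, it would be coprime to b ^ M and divide a.
  prime∣base⇒prime∣base : ∀ M {s} a b a' b' → Prime s → Free M a → a * b ^ M ≡ a' * b' ^ M → s ∣ b' → s ∣ b
  prime∣base⇒prime∣base M {s} a b a' b' ps free eq s∣b' with s ∣? b
  ... | yes s∣b = s∣b
  ... | no s∤b = ⊥-elim (free s ps (coprime-divisor s^M⊥b^M s^M∣b^M*a))
    where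
    s^M∣b^M*a : s ^ M ∣ b ^ M * a
    s^M∣b^M*a = subst (s ^ M ∣_) (trans (sym eq) (*-comm a _)) (∣n⇒∣m*n a' (∣⇒^∣^ M s∣b'))
    s^M⊥b^M : Coprime (s ^ M) (b ^ M)
    s^M⊥b^M = noCommonPrime⇒coprime _ _ λ t pt t∣s^M t∣b^M →
      s∤b (subst (_∣ b) (prime∣prime^⇒≡ M pt ps t∣s^M) (prime∣^⇒∣ M pt t∣b^M))

  *^-cancelʳ : ∀ M s {{_ : NonZero s}} a c a' c' → a * (c * s) ^ M ≡ a' * (c' * s) ^ M → a * c ^ M ≡ a' * c' ^ M
  *^-cancelʳ M s a c a' c' eq = *-cancelʳ-≡ (a * c ^ M) (a' * c' ^ M) (s ^ M) {{m^n≢0 s M}} (begin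
    a * c ^ M * s ^ M      ≡⟨ *-assoc a (c ^ M) (s ^ M) ⟩
    a * (c ^ M * s ^ M)    ≡⟨ cong (a *_) (sym (^-distribʳ-* c s M)) ⟩
    a * (c * s) ^ M        ≡⟨ eq ⟩
    a' * (c' * s) ^ M      ≡⟨ cong (a' *_) (^-distribʳ-* c' s M) ⟩
    a' * (c' ^ M * s ^ M)  ≡⟨ sym (*-assoc a' (c' ^ M) (s ^ M)) ⟩
    a' * c' ^ M * s ^ M    ∎)
    where open ≡-Reasoning

  -- Strong induction on b: a common prime factor of b and b' is cancelled.
  free*^-unique : ∀ M a b a' b' → 0 < b → 0 < b' → Free M a → Free M a' →
                  a * b ^ M ≡ a' * b' ^ M → a ≡ a' × b ≡ b'
  free*^-unique M a b a' b' = go b a b a' b' ≤-refl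
    where
    go : ∀ fuel a b a' b' → b ≤ fuel → 0 < b → 0 < b' → Free M a → Free M a' →
         a * b ^ M ≡ a' * b' ^ M → a ≡ a' × b ≡ b'
    go fuel a 1 a' 1 _ _ _ _ _ eq = *-cancelʳ-≡ a a' (1 ^ M) {{m^n≢0 1 M}} eq , refl
    go fuel a 1 a' b'@(suc (suc _)) _ _ _ free _ eq with ∃primeDivisor b' (s≤s (s≤s z≤n))
    ... | s , ps , s∣b' = ⊥-elim (prime⇒≢1 ps (∣1⇒≡1 (prime∣base⇒prime∣base M a 1 a' b' ps free eq s∣b')))
    go (suc fuel) a b@(suc (suc _)) a' b' b≤1+fuel _ 0<b' free free' eq with ∃primeDivisor b (s≤s (s≤s z≤n))
    ... | s , ps , s∣b = cancelCommonPrime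
      where
      instance
        s-nonZero : NonZero s
        s-nonZero = prime⇒nonZero ps
      s∣b' : s ∣ b'
      s∣b' = prime∣base⇒prime∣base M a' b' a b ps free' (sym eq) s∣b
      c c' : ℕ
      c = quotient s∣b
      c' = quotient s∣b'
      b≡c*s : b ≡ c * s
      b≡c*s = _∣_.equality s∣b
      b'≡c'*s : b' ≡ c' * s
      b'≡c'*s = _∣_.equality s∣b'
      0<c : 0 < c
      0<c = >-nonZero⁻¹ c {{m*n≢0⇒m≢0 c {{subst NonZero b≡c*s _}}}}
      0<c' : 0 < c'
      0<c' = >-nonZero⁻¹ c' {{m*n≢0⇒m≢0 c' {{subst NonZero b'≡c'*s (>-nonZero 0<b')}}}}
      c≤fuel : c ≤ fuel
      c≤fuel = ≤-pred (≤-trans (subst (c <_) (sym b≡c*s) (m<m*n c s {{>-nonZero 0<c}} (prime⇒2≤ ps))) b≤1+fuel)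
      cancelCommonPrime : a ≡ a' × b ≡ b'
      cancelCommonPrime with go fuel a c a' c' c≤fuel 0<c 0<c' free free'
                               (*^-cancelʳ M s a c a' c' (subst₂ (λ x y → a * x ^ M ≡ a' * y ^ M) b≡c*s b'≡c'*s eq))
      ... | a≡a' , c≡c' = a≡a' , trans b≡c*s (trans (cong (_* s) c≡c') (sym b'≡c'*s))

  pairs⁺ : ∀ {a b n} → 0 < a → a ≤ n → 0 < b → b ≤ n → (a , b) ∈ pairs n
  pairs⁺ {a} {b} {n} 0<a a≤n 0<b b≤n =
    ∈-concat⁺′ (∈-map⁺ (a ,_) (range1⁺ 0<b b≤n)) (∈-map⁺ (λ a → map (a ,_) (range1 n)) (range1⁺ 0<a a≤n))

  pairs⁻ : ∀ {a b n} → (a , b) ∈ pairs n → 0 < b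
  pairs⁻ {n = n} ab∈ with ∈-concat⁻′ (map (λ a → map (a ,_) (range1 n)) (range1 n)) ab∈
  ... | _ , ab∈row , row∈ with ∈-map⁻ (λ a → map (a ,_) (range1 n)) row∈
  ... | a , _ , refl with ∈-map⁻ (a ,_) ab∈row
  ... | _ , b∈ , refl = proj₁ (range1⁻ b∈)

  decomp≡ : ∀ m n a b → a * b ^ suc m ≡ n → Free (suc m) a → 0 < b → decomp (suc m) n ≡ (a , b ^ suc m)
  decomp≡ zero n a b eq free _ with refl ← free[1]⇒≡1 a free = cong (1 ,_) (trans (sym eq) (*-identityˡ _))
  decomp≡ m@(suc _) n a b eq free 0<b with filter (isDecomp? (suc m) n) (pairs n) in found
  ... | [] = contradiction (subst ((a , b) ∈_) found (∈-filter⁺ (isDecomp? (suc m) n) (pairs⁺ 0<a a≤n 0<b b≤n) (eq , free))) λ ()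
    where
    0<a : 0 < a
    0<a = free⇒>0 m a free
    instance
      n-nonZero : NonZero n
      n-nonZero = subst NonZero eq (m*n≢0 a (b ^ suc m) {{>-nonZero 0<a}} {{m^n≢0 b (suc m) {{>-nonZero 0<b}}}})
    a≤n : a ≤ n
    a≤n = ∣⇒≤ (divides (b ^ suc m) (trans (sym eq) (*-comm a _)))
    b≤n : b ≤ n
    b≤n = ∣⇒≤ (∣-trans (m∣m*n (b ^ m)) (divides a (sym eq)))
  ... | (a' , b') ∷ _ with ∈-filter⁻ (isDecomp? (suc m) n) {xs = pairs n} (subst ((a' , b') ∈_) (sym found) (here refl))
  ... | ab'∈ , (eq' , free') with free*^-unique (suc m) a b a' b' 0<b (pairs⁻ {n = n} ab'∈) free free' (trans eq (sym eq'))
  ... | refl , refl = refl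

module Totient where

  open Arithmetic
  open RangeLists
  open import Defs using (φ; range1)
  open import Data.Nat
  open import Data.Nat.Properties
  open import Data.Nat.Divisibility
  open import Data.Nat.Primality
  open import Data.Nat.Coprimality using (Coprime; coprime?; coprime-+)
  import Data.Nat.Coprimality as Coprime
  open import Data.List using (List; []; _∷_; map; filter; length; _++_; [_])
  open import Data.List.Properties using (map-++; length-++; filter-++; filter-≐; filter-none)
  open import Data.List.Membership.Propositional using (_∈_)
  open import Data.List.Relation.Unary.All using (tabulate)
  open import Data.Product using (_×_; _,_; proj₁; proj₂)
  open import Relation.Nullary using (¬_; yes; no)
  open import Relation.Nullary.Decidable using (_×-dec_; ¬?)
  open import Relation.Unary using (Decidable; _≐_)
  open import Relation.Binary.PropositionalEquality hiding ([_])
  open import Function using (_∘_)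

  count : {P : ℕ → Set} → Decidable P → List ℕ → ℕ
  count P? xs = length (filter P? xs)

  count-++ : ∀ {P : ℕ → Set} (P? : Decidable P) xs ys → count P? (xs ++ ys) ≡ count P? xs + count P? ys
  count-++ P? xs ys = trans (cong length (filter-++ P? xs ys)) (length-++ (filter P? xs))

  count-map : ∀ {P : ℕ → Set} (P? : Decidable P) f xs → count P? (map f xs) ≡ count (λ x → P? (f x)) xs
  count-map P? f [] = refl
  count-map P? f (x ∷ xs) with P? (f x)
  ... | yes _ = cong suc (count-map P? f xs)
  ... | no _ = count-map P? f xs

  count-≐ : ∀ {P Q : ℕ → Set} (P? : Decidable P) (Q? : Decidable Q) → P ≐ Q → ∀ xs → count P? xs ≡ count Q? xs
  count-≐ P? Q? P≐Q xs = cong length (filter-≐ P? Q? P≐Q xs)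

  count-none : ∀ {P : ℕ → Set} (P? : Decidable P) xs → (∀ {x} → x ∈ xs → ¬ P x) → count P? xs ≡ 0
  count-none P? xs ¬P = cong length (filter-none P? (tabulate ¬P))

  count-split : ∀ {P Q : ℕ → Set} (P? : Decidable P) (Q? : Decidable Q) xs →
                count P? xs ≡ count (λ x → P? x ×-dec ¬? (Q? x)) xs + count (λ x → P? x ×-dec Q? x) xs
  count-split P? Q? [] = refl
  count-split P? Q? (x ∷ xs) with P? x | Q? x
  ... | yes _ | yes _ = trans (cong suc (count-split P? Q? xs)) (sym (+-suc _ _))
  ... | yes _ | no _ = cong suc (count-split P? Q? xs)
  ... | no _ | yes _ = count-split P? Q? xs
  ... | no _ | no _ = count-split P? Q? xs

  coprimeTo : ∀ n → Decidable (λ i → Coprime i n)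
  coprimeTo n i = coprime? i n

  count-coprime-range1-* : ∀ n c → count (coprimeTo n) (range1 (c * n)) ≡ c * φ n
  count-coprime-range1-* n zero = refl
  count-coprime-range1-* n (suc c) = begin
    count C (range1 (n + c * n))                        ≡⟨ cong (count C) (range1-+ n (c * n)) ⟩
    count C (range1 n ++ map (n +_) (range1 (c * n)))   ≡⟨ count-++ C (range1 n) _ ⟩
    φ n + count C (map (n +_) (range1 (c * n)))         ≡⟨ cong (φ n +_) (count-map C (n +_) (range1 (c * n))) ⟩
    φ n + count (λ i → C (n + i)) (range1 (c * n))      ≡⟨ cong (φ n +_) (count-≐ _ C shift (range1 (c * n))) ⟩
    φ n + count C (range1 (c * n))                      ≡⟨ cong (φ n +_) (count-coprime-range1-* n c) ⟩
    φ n + c * φ n                                       ∎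
    where
    open ≡-Reasoning
    C : Decidable (λ i → Coprime i n)
    C = coprimeTo n
    shift : (λ i → Coprime (n + i) n) ≐ (λ i → Coprime i n)
    shift = (λ n+i⊥n (d∣i , d∣n) → n+i⊥n (∣m∣n⇒∣m+n d∣n d∣i , d∣n)) , coprime-+

  φ-*-∣ : ∀ q Y → q ∣ Y → φ (q * Y) ≡ q * φ Y
  φ-*-∣ q Y q∣Y = trans (count-≐ (coprimeTo (q * Y)) (coprimeTo Y) same (range1 (q * Y))) (count-coprime-range1-* Y q)
    where
    same : (λ i → Coprime i (q * Y)) ≐ (λ i → Coprime i Y)
    same = (λ i⊥qY → coprime-∣ʳ i⊥qY (n∣m*n q)) , (λ i⊥Y → coprime-* (coprime-∣ʳ i⊥Y q∣Y) i⊥Y)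

  -- In each block (qX, qX + q] the only multiple of q is its right end.
  count-multiples : ∀ q' X {P : ℕ → Set} (P? : Decidable P) → let q = suc q' in
                    count (λ i → P? i ×-dec (q ∣? i)) (range1 (q * X)) ≡ count (λ j → P? (q * j)) (range1 X)
  count-multiples q' zero P? = cong (λ n → count (λ i → P? i ×-dec (suc q' ∣? i)) (range1 n)) (*-zeroʳ q')
  count-multiples q' (suc X) {P} P? = begin
    count D (range1 (q * suc X))                                      ≡⟨ cong (count D ∘ range1) (trans (*-suc q X) (+-comm q (q * X))) ⟩
    count D (range1 (q * X + q))                                      ≡⟨ cong (count D) (range1-+ (q * X) q) ⟩
    count D (range1 (q * X) ++ map (q * X +_) (range1 q))             ≡⟨ count-++ D (range1 (q * X)) _ ⟩
    count D (range1 (q * X)) + count D (map (q * X +_) (range1 q))    ≡⟨ cong₂ _+_ (count-multiples q' X P?) lastBlock ⟩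
    count E (range1 X) + count E [ suc X ]                            ≡⟨ sym (count-++ E (range1 X) [ suc X ]) ⟩
    count E (range1 X ++ [ suc X ])                                   ≡⟨ cong (count E) (sym (range1-suc X)) ⟩
    count E (range1 (suc X))                                          ∎
    where
    open ≡-Reasoning
    q : ℕ
    q = suc q'
    D : Decidable (λ i → P i × q ∣ i)
    D = λ i → P? i ×-dec (q ∣? i)
    E : Decidable (λ j → P (q * j))
    E = λ j → P? (q * j)
    noMultiple : ∀ {r} → r ∈ range1 q' → ¬ (q ∣ q * X + r)
    noMultiple r∈ q∣qX+r with range1⁻ r∈
    ... | 0<r , r≤q' = <⇒≱ (s≤s r≤q') (∣⇒≤ {{>-nonZero 0<r}} (∣m+n∣m⇒∣n q∣qX+r (m∣m*n X)))
    noneInside : count D (map (q * X +_) (range1 q')) ≡ 0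
    noneInside = trans (count-map D (q * X +_) (range1 q')) (count-none _ (range1 q') (λ r∈ → noMultiple r∈ ∘ proj₂))
    lastBlock : count D (map (q * X +_) (range1 q)) ≡ count E [ suc X ]
    lastBlock = begin
      count D (map (q * X +_) (range1 q))                                   ≡⟨ cong (count D ∘ map (q * X +_)) (range1-suc q') ⟩
      count D (map (q * X +_) (range1 q' ++ [ q ]))                         ≡⟨ cong (count D) (map-++ (q * X +_) (range1 q') [ q ]) ⟩
      count D (map (q * X +_) (range1 q') ++ [ q * X + q ])                 ≡⟨ count-++ D (map (q * X +_) (range1 q')) _ ⟩
      count D (map (q * X +_) (range1 q')) + count D [ q * X + q ]          ≡⟨ cong₂ _+_ noneInside (cong (count D ∘ [_]) (trans (+-comm (q * X) q) (sym (*-suc q X)))) ⟩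
      count D [ q * suc X ]                                                 ≡⟨ count-map D (q *_) [ suc X ] ⟩
      count (λ j → D (q * j)) [ suc X ]                                     ≡⟨ count-≐ (λ j → D (q * j)) E (proj₁ , λ {j} P[qj] → P[qj] , m∣m*n j) [ suc X ] ⟩
      count E [ suc X ]                                                     ∎

  -- Of the q φ X integers in [1, q X] coprime to X, those prime to q are counted by φ (q X), the multiples q j by φ X.
  φ-*-prime : ∀ q X → Prime q → ¬ (q ∣ X) → φ (q * X) + φ X ≡ q * φ X
  φ-*-prime q@(suc q') X pq q∤X = begin
    φ (q * X) + φ X                                     ≡⟨ cong₂ _+_ (count-≐ _ A coprimeTo-qX (range1 (q * X))) (sym countB≡φX) ⟩
    count A (range1 (q * X)) + count B (range1 (q * X)) ≡⟨ sym (count-split (coprimeTo X) (q ∣?_) (range1 (q * X))) ⟩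
    count (coprimeTo X) (range1 (q * X))                ≡⟨ count-coprime-range1-* X q ⟩
    q * φ X                                             ∎
    where
    open ≡-Reasoning
    A : Decidable (λ i → Coprime i X × ¬ (q ∣ i))
    A = λ i → coprime? i X ×-dec ¬? (q ∣? i)
    B : Decidable (λ i → Coprime i X × q ∣ i)
    B = λ i → coprime? i X ×-dec (q ∣? i)
    coprimeTo-qX : (λ i → Coprime i (q * X)) ≐ (λ i → Coprime i X × ¬ (q ∣ i))
    coprimeTo-qX = (λ i⊥qX → coprime-∣ʳ i⊥qX (n∣m*n q) , λ q∣i → prime⇒≢1 pq (i⊥qX (q∣i , m∣m*n X)))
                 , (λ (i⊥X , q∤i) → coprime-* (Coprime.sym (prime∤⇒coprime pq q∤i)) i⊥X)
    coprimeTo-X : (λ j → Coprime (q * j) X) ≐ (λ j → Coprime j X)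
    coprimeTo-X = (λ qj⊥X (d∣j , d∣X) → qj⊥X (∣n⇒∣m*n q d∣j , d∣X))
                , (λ j⊥X → Coprime.sym (coprime-* (Coprime.sym (prime∤⇒coprime pq q∤X)) (Coprime.sym j⊥X)))
    countB≡φX : count B (range1 (q * X)) ≡ φ X
    countB≡φX = trans (count-multiples q' X (coprimeTo X)) (count-≐ _ (coprimeTo X) coprimeTo-X (range1 X))

  φ-*-prime′ : ∀ q X → Prime q → ¬ (q ∣ X) → φ (q * X) ≡ (q ∸ 1) * φ X
  φ-*-prime′ q X pq q∤X = begin
    φ (q * X)                ≡⟨ sym (m+n∸n≡m (φ (q * X)) (φ X)) ⟩
    φ (q * X) + φ X ∸ φ X    ≡⟨ cong (_∸ φ X) (φ-*-prime q X pq q∤X) ⟩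
    q * φ X ∸ φ X            ≡⟨ cong (q * φ X ∸_) (sym (*-identityˡ (φ X))) ⟩
    q * φ X ∸ 1 * φ X        ≡⟨ sym (*-distribʳ-∸ (φ X) q 1) ⟩
    (q ∸ 1) * φ X            ∎
    where open ≡-Reasoning

  φ-prime^-* : ∀ q X → Prime q → ¬ (q ∣ X) → ∀ e → φ (q ^ suc e * X) ≡ q ^ e * ((q ∸ 1) * φ X)
  φ-prime^-* q X pq q∤X zero = trans (cong (λ r → φ (r * X)) (*-identityʳ q)) (trans (φ-*-prime′ q X pq q∤X) (sym (*-identityˡ _)))
  φ-prime^-* q X pq q∤X (suc e) = begin
    φ (q * q ^ suc e * X)              ≡⟨ cong φ (*-assoc q (q ^ suc e) X) ⟩
    φ (q * (q ^ suc e * X))            ≡⟨ φ-*-∣ q (q ^ suc e * X) (∣m⇒∣m*n X (m∣m*n (q ^ e))) ⟩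
    q * φ (q ^ suc e * X)              ≡⟨ cong (q *_) (φ-prime^-* q X pq q∤X e) ⟩
    q * (q ^ e * ((q ∸ 1) * φ X))      ≡⟨ sym (*-assoc q (q ^ e) _) ⟩
    q * q ^ e * ((q ∸ 1) * φ X)        ∎
    where open ≡-Reasoning

module Denominators (p : ℕ → ℕ) (p-prime : ∀ i → Prime (p i)) (p-increasing : ∀ i → p i ℕ.< p (suc i)) (m₀ : ℕ) where

  open Arithmetic
  open ExponentVectors p p-prime p-increasing
  open FreePowerDecomposition
  open Totient
  open import Defs using (Free; φ; decomp; freePart; powerPart)
  open import Data.Nat
  open import Data.Nat.Properties
  open import Data.Nat.Divisibility using (_∣_)
  open import Data.Vec using (Vec; []; _∷_; map)
  open import Data.Vec.Relation.Unary.All using (All; []; _∷_)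
  open import Data.Vec.Relation.Unary.All.Properties using (gmap)
  open import Data.Product using (_×_; _,_; proj₁; proj₂)
  open import Relation.Nullary using (¬_; yes; no; contradiction)
  open import Relation.Binary.PropositionalEquality
  open import Data.Nat.Solver using (module +-*-Solver)
  open +-*-Solver using (solve; _:*_; _:=_)

  m : ℕ
  m = suc m₀

  -- For e ≤ m, the m-free part of p ^ e is p ^ freeExponent e and its m-power part is (p ^ powerExponent e) ^ m.
  freeExponent : ℕ → ℕ
  freeExponent e with e ≟ m
  ... | yes _ = 0
  ... | no _ = e

  powerExponent : ℕ → ℕ
  powerExponent e with e ≟ m
  ... | yes _ = 1
  ... | no _ = 0

  totientFactor : ℕ → ℕ → ℕ
  totientFactor j e with e ≟ m
  ... | yes _ = p j ^ m₀ * (p j ∸ 1)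
  ... | no _ = 1

  denominator : ℕ → ℕ → ℕ
  denominator j e = p j ^ freeExponent e * totientFactor j e

  freePartOf powerBaseOf : ∀ {j} → Vec ℕ j → ℕ
  freePartOf v = ⟦ map freeExponent v ⟧
  powerBaseOf v = ⟦ map powerExponent v ⟧

  totientOf denominatorOf : ∀ {j} → Vec ℕ j → ℕ
  totientOf [] = 1
  totientOf {suc j} (e ∷ v) = totientFactor j e * totientOf v
  denominatorOf [] = 1
  denominatorOf {suc j} (e ∷ v) = denominator j e * denominatorOf v

  ^-split : ∀ q e → e < suc m → q ^ freeExponent e * (q ^ powerExponent e) ^ m ≡ q ^ e
  ^-split q e _ with e ≟ m
  ... | yes refl = trans (*-identityˡ _) (cong (_^ m) (*-identityʳ q))
  ... | no _ = trans (cong (q ^ e *_) (^-zeroˡ m)) (*-identityʳ _)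

  ⟦⟧-split : ∀ {j} (v : Vec ℕ j) → All (_< suc m) v → freePartOf v * powerBaseOf v ^ m ≡ ⟦ v ⟧
  ⟦⟧-split [] [] = cong (1 *_) (^-zeroˡ m)
  ⟦⟧-split {suc j} (e ∷ v) (e≤m ∷ v≤m) = begin
    q ^ a * A * (q ^ b * B) ^ m        ≡⟨ cong (q ^ a * A *_) (^-distribʳ-* (q ^ b) B m) ⟩
    q ^ a * A * ((q ^ b) ^ m * B ^ m)  ≡⟨ solve 4 (λ x A y B → x :* A :* (y :* B) := x :* y :* (A :* B)) refl (q ^ a) A ((q ^ b) ^ m) (B ^ m) ⟩
    q ^ a * (q ^ b) ^ m * (A * B ^ m)  ≡⟨ cong₂ _*_ (^-split q e e≤m) (⟦⟧-split v v≤m) ⟩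
    q ^ e * ⟦ v ⟧                      ∎
    where
    open ≡-Reasoning
    q a b A B : ℕ
    q = p j
    a = freeExponent e
    b = powerExponent e
    A = freePartOf v
    B = powerBaseOf v

  freeExponent< : ∀ {e} → e < suc m → freeExponent e < m
  freeExponent< {e} e≤m with e ≟ m
  ... | yes _ = s≤s z≤n
  ... | no e≢m = ≤∧≢⇒< (≤-pred e≤m) e≢m

  freePartOf-free : ∀ {j} (v : Vec ℕ j) → All (_< suc m) v → Free m (freePartOf v)
  freePartOf-free v v≤m = exponents<⇒free m₀ (map freeExponent v) (gmap freeExponent< v≤m)

  freePart-⟦⟧ : ∀ {j} (v : Vec ℕ j) → All (_< suc m) v → freePart m ⟦ v ⟧ ≡ freePartOf v × powerPart m ⟦ v ⟧ ≡ powerBaseOf v ^ m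
  freePart-⟦⟧ v v≤m = cong proj₁ decomp[v] , cong proj₂ decomp[v]
    where
    decomp[v] : decomp m ⟦ v ⟧ ≡ (freePartOf v , powerBaseOf v ^ m)
    decomp[v] = decomp≡ m₀ ⟦ v ⟧ (freePartOf v) (powerBaseOf v) (⟦⟧-split v v≤m) (freePartOf-free v v≤m)
                  (>-nonZero⁻¹ _ {{⟦⟧-nonZero (map powerExponent v)}})

  φ-powerBaseOf : ∀ {j} (v : Vec ℕ j) → φ (powerBaseOf v ^ m) ≡ totientOf v
  φ-powerBaseOf [] = cong φ (^-zeroˡ m)
  φ-powerBaseOf {suc j} (e ∷ v) with e ≟ m
  ... | yes _ = begin
    φ ((q ^ 1 * B) ^ m)              ≡⟨ cong φ (^-distribʳ-* (q ^ 1) B m) ⟩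
    φ ((q ^ 1) ^ m * B ^ m)          ≡⟨ cong (λ x → φ (x ^ m * B ^ m)) (*-identityʳ q) ⟩
    φ (q ^ m * B ^ m)                ≡⟨ φ-prime^-* q (B ^ m) (p-prime j) q∤B^m m₀ ⟩
    q ^ m₀ * ((q ∸ 1) * φ (B ^ m))   ≡⟨ cong (λ x → q ^ m₀ * ((q ∸ 1) * x)) (φ-powerBaseOf v) ⟩
    q ^ m₀ * ((q ∸ 1) * totientOf v) ≡⟨ sym (*-assoc (q ^ m₀) (q ∸ 1) (totientOf v)) ⟩
    q ^ m₀ * (q ∸ 1) * totientOf v   ∎
    where
    open ≡-Reasoning
    q B : ℕ
    q = p j
    B = powerBaseOf v
    q∤B^m : ¬ (q ∣ B ^ m)
    q∤B^m q∣B^m = p∤⟦⟧ (map powerExponent v) (prime∣^⇒∣ m (p-prime j) q∣B^m)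
  ... | no _ = begin
    φ ((p j ^ 0 * B) ^ m)      ≡⟨ cong (λ x → φ (x ^ m)) (*-identityˡ B) ⟩
    φ (B ^ m)                  ≡⟨ φ-powerBaseOf v ⟩
    totientOf v                ≡⟨ sym (*-identityˡ (totientOf v)) ⟩
    1 * totientOf v            ∎
    where
    open ≡-Reasoning
    B : ℕ
    B = powerBaseOf v

  freePartOf*totientOf : ∀ {j} (v : Vec ℕ j) → freePartOf v * totientOf v ≡ denominatorOf v
  freePartOf*totientOf [] = refl
  freePartOf*totientOf {suc j} (e ∷ v) =
    trans (solve 4 (λ a A c C → a :* A :* (c :* C) := a :* c :* (A :* C)) refl (p j ^ freeExponent e) (freePartOf v) (totientFactor j e) (totientOf v))
          (cong (denominator j e *_) (freePartOf*totientOf v))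

  freePart*φ[powerPart]-⟦⟧ : ∀ {j} (v : Vec ℕ j) → All (_< suc m) v → freePart m ⟦ v ⟧ * φ (powerPart m ⟦ v ⟧) ≡ denominatorOf v
  freePart*φ[powerPart]-⟦⟧ v v≤m with freePart-⟦⟧ v v≤m
  ... | free≡ , power≡ = trans (cong₂ _*_ free≡ (trans (cong φ power≡) (φ-powerBaseOf v))) (freePartOf*totientOf v)

  denominator-< : ∀ j {e} → e < m → denominator j e ≡ p j ^ e
  denominator-< j {e} e<m with e ≟ m
  ... | yes refl = contradiction e<m (<-irrefl refl)
  ... | no _ = *-identityʳ _

  denominator-m : ∀ j → denominator j m ≡ p j ^ m₀ * (p j ∸ 1)
  denominator-m j with m ≟ m
  ... | yes _ = *-identityˡ _
  ... | no m≢m = contradiction refl m≢m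

  denominator-nonZero : ∀ j e → NonZero (denominator j e)
  denominator-nonZero j e with e ≟ m
  ... | yes _ = m*n≢0 1 _ {{_}} {{m*n≢0 (p j ^ m₀) (p j ∸ 1) {{m^n≢0 (p j) m₀}}}}
  ... | no _ = m*n≢0 (p j ^ e) 1 {{m^n≢0 (p j) e}}

  denominatorOf-nonZero : ∀ {j} (v : Vec ℕ j) → NonZero (denominatorOf v)
  denominatorOf-nonZero [] = _
  denominatorOf-nonZero {suc j} (e ∷ v) = m*n≢0 _ _ {{denominator-nonZero j e}} {{denominatorOf-nonZero v}}

module RationalArithmetic where

  open import Defs using (inv)
  open import Data.Nat as ℕ using (ℕ; zero; suc)
  import Data.Nat.Properties as ℕ
  import Data.Integer as ℤ
  import Data.Integer.Properties as ℤ
  open import Data.Nat.Coprimality using (1-coprimeTo)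
  import Data.Nat.Coprimality as Coprime
  open import Data.Rational using (ℚ; mkℚ; 0ℚ; 1ℚ; _+_; _*_; _-_; -_; _≤_; _<_; ∣_∣; 1/_; _/_; *≤*; *<*; nonNegative; +-*-rawSemiring)
  open import Data.Rational.Properties
  open import Algebra.Definitions.RawSemiring +-*-rawSemiring public using () renaming (_^_ to _^ℚ_)
  open import Data.Product using (_,_; ∃-syntax)
  open import Relation.Binary.PropositionalEquality
  open import Data.Rational.Solver using (module +-*-Solver)
  open +-*-Solver using (solve; _:+_; _:*_; _:-_; :-_; _:=_; con)

  fromℕ : ℕ → ℚ
  fromℕ n = mkℚ (ℤ.+ n) 0 (Coprime.sym (1-coprimeTo n))

  fromℕ-* : ∀ a b → fromℕ a * fromℕ b ≡ fromℕ (a ℕ.* b)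
  fromℕ-* a b = trans (cong (_/ 1) (sym (ℤ.pos-* a b))) (normalize-coprime (Coprime.sym (1-coprimeTo (a ℕ.* b))))

  fromℕ-+ : ∀ a b → fromℕ a + fromℕ b ≡ fromℕ (a ℕ.+ b)
  fromℕ-+ a b = trans (cong (_/ 1) (trans (cong₂ ℤ._+_ (ℤ.*-identityʳ (ℤ.+ a)) (ℤ.*-identityʳ (ℤ.+ b))) (sym (ℤ.pos-+ a b))))
                      (normalize-coprime (Coprime.sym (1-coprimeTo (a ℕ.+ b))))

  fromℕ-nonNeg : ∀ n → 0ℚ ≤ fromℕ n
  fromℕ-nonNeg n = nonNegative⁻¹ (fromℕ n)

  fromℕ-mono-< : ∀ {a b} → a ℕ.< b → fromℕ a < fromℕ b
  fromℕ-mono-< {a} {b} a<b = *<* (subst₂ ℤ._<_ (sym (ℤ.*-identityʳ (ℤ.+ a))) (sym (ℤ.*-identityʳ (ℤ.+ b))) (ℤ.+<+ a<b))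

  inv≡1/fromℕ : ∀ d → inv (suc d) ≡ 1/ fromℕ (suc d)
  inv≡1/fromℕ d = normalize-coprime (1-coprimeTo (suc d))

  inv-inverseˡ : ∀ d → .{{ℕ.NonZero d}} → inv d * fromℕ d ≡ 1ℚ
  inv-inverseˡ (suc d) = trans (cong (_* fromℕ (suc d)) (inv≡1/fromℕ d)) (*-inverseˡ (fromℕ (suc d)))

  inv-* : ∀ a b → .{{ℕ.NonZero a}} → .{{ℕ.NonZero b}} → inv (a ℕ.* b) ≡ inv a * inv b
  inv-* a@(suc _) b@(suc _) = inverse-unique (inv (a ℕ.* b)) (inv a * inv b) (inv-inverseˡ (a ℕ.* b)) (begin
    inv a * inv b * fromℕ (a ℕ.* b)             ≡⟨ cong (inv a * inv b *_) (sym (fromℕ-* a b)) ⟩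
    inv a * inv b * (fromℕ a * fromℕ b)         ≡⟨ solve 4 (λ x y X Y → x :* y :* (X :* Y) := x :* X :* (y :* Y)) refl (inv a) (inv b) (fromℕ a) (fromℕ b) ⟩
    inv a * fromℕ a * (inv b * fromℕ b)         ≡⟨ cong₂ _*_ (inv-inverseˡ a) (inv-inverseˡ b) ⟩
    1ℚ                                          ∎)
    where
    open ≡-Reasoning
    inverse-unique : ∀ u w → u * fromℕ (a ℕ.* b) ≡ 1ℚ → w * fromℕ (a ℕ.* b) ≡ 1ℚ → u ≡ w
    inverse-unique u w u*n≡1 w*n≡1 = begin
      u                                ≡⟨ sym (*-identityʳ u) ⟩
      u * 1ℚ                           ≡⟨ cong (u *_) (sym w*n≡1) ⟩
      u * (w * fromℕ (a ℕ.* b))        ≡⟨ solve 3 (λ u w n → u :* (w :* n) := w :* (u :* n)) refl u w (fromℕ (a ℕ.* b)) ⟩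
      w * (u * fromℕ (a ℕ.* b))        ≡⟨ cong (w *_) u*n≡1 ⟩
      w * 1ℚ                           ≡⟨ *-identityʳ w ⟩
      w                                ∎

  inv-nonNeg : ∀ d → 0ℚ ≤ inv d
  inv-nonNeg zero = ≤-refl
  inv-nonNeg (suc d) = nonNegative⁻¹ (inv (suc d)) {{normalize-nonNeg 1 (suc d)}}

  inv≤1 : ∀ d → .{{ℕ.NonZero d}} → inv d ≤ 1ℚ
  inv≤1 (suc d) = subst (_≤ 1ℚ) (sym (inv≡1/fromℕ d)) (*≤* (ℤ.+≤+ (ℕ.s≤s ℕ.z≤n)))

  inv-antimono-≤ : ∀ {a b} → .{{ℕ.NonZero a}} → a ℕ.≤ b → inv b ≤ inv a
  inv-antimono-≤ {suc a} {suc b} a≤b = subst₂ _≤_ (sym (inv≡1/fromℕ b)) (sym (inv≡1/fromℕ a))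
    (*≤* (subst₂ ℤ._≤_ (sym (ℤ.*-identityˡ (ℤ.+ suc a))) (sym (ℤ.*-identityˡ (ℤ.+ suc b))) (ℤ.+≤+ a≤b)))

  *-monoʳ-≤-0≤ : ∀ {r p q} → 0ℚ ≤ r → p ≤ q → r * p ≤ r * q
  *-monoʳ-≤-0≤ {r} 0≤r p≤q = *-monoˡ-≤-nonNeg r {{nonNegative 0≤r}} p≤q

  *-mono-≤-0≤ : ∀ {a b c d} → 0ℚ ≤ a → 0ℚ ≤ c → a ≤ b → c ≤ d → a * c ≤ b * d
  *-mono-≤-0≤ {a} {b} {c} {d} 0≤a 0≤c a≤b c≤d =
    ≤-trans (*-monoʳ-≤-0≤ 0≤a c≤d) (subst₂ _≤_ (*-comm d a) (*-comm d b) (*-monoʳ-≤-0≤ (≤-trans 0≤c c≤d) a≤b))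

  *-0≤ : ∀ {a b} → 0ℚ ≤ a → 0ℚ ≤ b → 0ℚ ≤ a * b
  *-0≤ {a} {b} 0≤a 0≤b = subst (_≤ a * b) (*-zeroʳ a) (*-monoʳ-≤-0≤ 0≤a 0≤b)

  inv-^ : ∀ q → .{{ℕ.NonZero q}} → ∀ e → inv (q ℕ.^ e) ≡ inv q ^ℚ e
  inv-^ q zero = refl
  inv-^ q (suc e) = trans (inv-* q (q ℕ.^ e)) (cong (inv q *_) (inv-^ q e))
    where
    instance
      q^e-nonZero : ℕ.NonZero (q ℕ.^ e)
      q^e-nonZero = ℕ.m^n≢0 q e

  ^ℚ-0≤ : ∀ {a} → 0ℚ ≤ a → ∀ e → 0ℚ ≤ a ^ℚ e
  ^ℚ-0≤ 0≤a zero = fromℕ-nonNeg 1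
  ^ℚ-0≤ 0≤a (suc e) = *-0≤ 0≤a (^ℚ-0≤ 0≤a e)

  ^ℚ-≤1 : ∀ {a} → 0ℚ ≤ a → a ≤ 1ℚ → ∀ e → a ^ℚ e ≤ 1ℚ
  ^ℚ-≤1 0≤a a≤1 zero = ≤-refl
  ^ℚ-≤1 {a} 0≤a a≤1 (suc e) = subst (a * a ^ℚ e ≤_) (*-identityˡ 1ℚ) (*-mono-≤-0≤ 0≤a (^ℚ-0≤ 0≤a e) a≤1 (^ℚ-≤1 0≤a a≤1 e))

  fromℕ*inv<inv : ∀ A B D → .{{ℕ.NonZero B}} → .{{ℕ.NonZero D}} → A ℕ.* B ℕ.< D → fromℕ A * inv D < inv B
  fromℕ*inv<inv A B D A*B<D = *-cancelʳ-<-nonNeg (fromℕ (B ℕ.* D)) {{nonNegative (fromℕ-nonNeg (B ℕ.* D))}}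
    (subst₂ _<_ (sym lhs) (sym rhs) (fromℕ-mono-< A*B<D))
    where
    open ≡-Reasoning
    lhs : fromℕ A * inv D * fromℕ (B ℕ.* D) ≡ fromℕ (A ℕ.* B)
    lhs = begin
      fromℕ A * inv D * fromℕ (B ℕ.* D)            ≡⟨ cong (fromℕ A * inv D *_) (sym (fromℕ-* B D)) ⟩
      fromℕ A * inv D * (fromℕ B * fromℕ D)        ≡⟨ solve 4 (λ a i b d → a :* i :* (b :* d) := a :* b :* (i :* d)) refl (fromℕ A) (inv D) (fromℕ B) (fromℕ D) ⟩
      fromℕ A * fromℕ B * (inv D * fromℕ D)        ≡⟨ cong₂ _*_ (fromℕ-* A B) (inv-inverseˡ D) ⟩
      fromℕ (A ℕ.* B) * 1ℚ                         ≡⟨ *-identityʳ _ ⟩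
      fromℕ (A ℕ.* B)                              ∎
    rhs : inv B * fromℕ (B ℕ.* D) ≡ fromℕ D
    rhs = begin
      inv B * fromℕ (B ℕ.* D)                      ≡⟨ cong (inv B *_) (sym (fromℕ-* B D)) ⟩
      inv B * (fromℕ B * fromℕ D)                  ≡⟨ sym (*-assoc (inv B) (fromℕ B) (fromℕ D)) ⟩
      inv B * fromℕ B * fromℕ D                    ≡⟨ cong (_* fromℕ D) (inv-inverseˡ B) ⟩
      1ℚ * fromℕ D                                 ≡⟨ *-identityˡ (fromℕ D) ⟩
      fromℕ D                                      ∎

  ∃inv≤ : ∀ ε → 0ℚ < ε → ∃[ b ] (inv (suc b) ≤ ε)
  ∃inv≤ (mkℚ (ℤ.+ suc a) b c) _ = b , subst (_≤ mkℚ (ℤ.+ suc a) b c) (sym (inv≡1/fromℕ b))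
    (*≤* (subst₂ ℤ._≤_ (ℤ.pos-* 1 (suc b)) (ℤ.pos-* (suc a) (suc b)) (ℤ.+≤+ (ℕ.*-monoˡ-≤ (suc b) {1} {suc a} (ℕ.s≤s ℕ.z≤n)))))
  ∃inv≤ (mkℚ (ℤ.+ zero) b c) (*<* (ℤ.+<+ ()))
  ∃inv≤ (mkℚ ℤ.-[1+ a ] b c) (*<* ())

  1-≤-swap : ∀ w s → 1ℚ - s ≤ w → 1ℚ - w ≤ s
  1-≤-swap w s 1-s≤w = subst₂ _≤_ (solve 2 (λ w s → (con 1ℚ :- s) :+ (s :- w) := con 1ℚ :- w) refl w s)
                                  (solve 2 (λ w s → w :+ (s :- w) := s) refl w s)
                                  (+-monoˡ-≤ (s - w) 1-s≤w)

  ∣-∣≤-between : ∀ {t l f} → f ≤ t → t ≤ l → ∣ t - l ∣ ≤ l - f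
  ∣-∣≤-between {t} {l} {f} f≤t t≤l = subst (_≤ l - f) (sym ∣t-l∣≡l-t) (+-monoʳ-≤ l (neg-antimono-≤ f≤t))
    where
    0≤l-t : 0ℚ ≤ l - t
    0≤l-t = subst (_≤ l - t) (+-inverseʳ t) (+-monoˡ-≤ (- t) t≤l)
    ∣t-l∣≡l-t : ∣ t - l ∣ ≡ l - t
    ∣t-l∣≡l-t = trans (sym (∣-p∣≡∣p∣ (t - l))) (trans (cong ∣_∣ (solve 2 (λ t l → :- (t :- l) := l :- t) refl t l)) (0≤p⇒∣p∣≡p 0≤l-t))

module FiniteSums where

  open RationalArithmetic
  open import Defs using (sumTo; range1)
  open RangeLists using (range1-suc)
  open import Data.Nat as ℕ using (ℕ; zero; suc)
  open import Data.Rational using (ℚ; 0ℚ; _+_; _*_; _≤_; _≟_)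
  open import Data.Rational.Properties hiding (_≟_)
  open import Data.List using (List; []; _∷_; _++_; map; upTo; [_])
  open import Data.List.Properties using (upTo-∷ʳ)
  open import Data.List.Membership.Propositional using (_∈_)
  open import Data.List.Membership.Propositional.Properties using (∈-∃++)
  open import Data.List.Relation.Unary.Any using (here; there)
  import Data.List.Relation.Unary.All as All
  open import Data.List.Relation.Unary.Unique.Propositional using (Unique)
  open import Data.List.Relation.Unary.AllPairs using (_∷_)
  open import Data.Product using (_,_)
  open import Data.Empty using (⊥-elim)
  open import Relation.Nullary using (yes; no)
  open import Relation.Binary.PropositionalEquality hiding ([_])
  open import Function using (_∘′_)
  open import Data.Rational.Solver using (module +-*-Solver)
  open +-*-Solver using (solve; _:+_; _:=_)

  sumℚ : {A : Set} → (A → ℚ) → List A → ℚ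
  sumℚ f [] = 0ℚ
  sumℚ f (x ∷ xs) = f x + sumℚ f xs

  module _ {A : Set} (f : A → ℚ) where

    sumℚ-++ : ∀ xs ys → sumℚ f (xs ++ ys) ≡ sumℚ f xs + sumℚ f ys
    sumℚ-++ [] ys = sym (+-identityˡ _)
    sumℚ-++ (x ∷ xs) ys = trans (cong (f x +_) (sumℚ-++ xs ys)) (sym (+-assoc (f x) _ _))

    sumℚ-snoc : ∀ xs x → sumℚ f (xs ++ [ x ]) ≡ sumℚ f xs + f x
    sumℚ-snoc xs x = trans (sumℚ-++ xs [ x ]) (cong (sumℚ f xs +_) (+-identityʳ (f x)))

    sumℚ-0≤ : (∀ x → 0ℚ ≤ f x) → ∀ xs → 0ℚ ≤ sumℚ f xs
    sumℚ-0≤ f≥0 [] = ≤-refl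
    sumℚ-0≤ f≥0 (x ∷ xs) = +-mono-≤ (f≥0 x) (sumℚ-0≤ f≥0 xs)

    sumℚ-cong : ∀ {g} xs → (∀ {x} → x ∈ xs → f x ≡ g x) → sumℚ f xs ≡ sumℚ g xs
    sumℚ-cong [] _ = refl
    sumℚ-cong (x ∷ xs) f≡g = cong₂ _+_ (f≡g (here refl)) (sumℚ-cong xs (f≡g ∘′ there))

    sumℚ-*ˡ : ∀ c xs → sumℚ (λ x → c * f x) xs ≡ c * sumℚ f xs
    sumℚ-*ˡ c [] = sym (*-zeroʳ c)
    sumℚ-*ˡ c (x ∷ xs) = trans (cong (c * f x +_) (sumℚ-*ˡ c xs)) (sym (*-distribˡ-+ c (f x) (sumℚ f xs)))

    sumℚ-mono-⊆ : (∀ x → 0ℚ ≤ f x) → ∀ xs ys → Unique xs → (∀ {x} → x ∈ xs → f x ≢ 0ℚ → x ∈ ys) → sumℚ f xs ≤ sumℚ f ys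
    sumℚ-mono-⊆ f≥0 [] ys _ _ = sumℚ-0≤ f≥0 ys
    sumℚ-mono-⊆ f≥0 (x ∷ xs) ys (x∉xs ∷ xs-unique) xs⊆ys with f x ≟ 0ℚ
    ... | yes fx≡0 = subst (_≤ sumℚ f ys) (trans (sym (+-identityˡ _)) (cong (_+ sumℚ f xs) (sym fx≡0)))
                       (sumℚ-mono-⊆ f≥0 xs ys xs-unique (xs⊆ys ∘′ there))
    ... | no fx≢0 with ∈-∃++ (xs⊆ys (here refl) fx≢0)
    ... | ys₁ , ys₂ , refl = subst (f x + sumℚ f xs ≤_) (sym (sumℚ-middle ys₁))
          (+-monoʳ-≤ (f x) (sumℚ-mono-⊆ f≥0 xs (ys₁ ++ ys₂) xs-unique
            (λ y∈xs fy≢0 → remove ys₁ (xs⊆ys (there y∈xs) fy≢0) (λ y≡x → All.lookup x∉xs y∈xs (sym y≡x)))))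
      where
      sumℚ-middle : ∀ ys₁ → sumℚ f (ys₁ ++ x ∷ ys₂) ≡ f x + sumℚ f (ys₁ ++ ys₂)
      sumℚ-middle [] = refl
      sumℚ-middle (y ∷ ys₁) = trans (cong (f y +_) (sumℚ-middle ys₁))
        (solve 3 (λ a b c → a :+ (b :+ c) := b :+ (a :+ c)) refl (f y) (f x) (sumℚ f (ys₁ ++ ys₂)))
      remove : ∀ {y} ys₁ → y ∈ ys₁ ++ x ∷ ys₂ → y ≢ x → y ∈ ys₁ ++ ys₂
      remove [] (here refl) y≢x = ⊥-elim (y≢x refl)
      remove [] (there y∈) _ = y∈
      remove (_ ∷ _) (here refl) _ = here refl
      remove (_ ∷ ys₁) (there y∈) y≢x = there (remove ys₁ y∈ y≢x)

  sumℚ-map : {A B : Set} (f : B → ℚ) (g : A → B) → ∀ xs → sumℚ f (map g xs) ≡ sumℚ (λ x → f (g x)) xs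
  sumℚ-map f g [] = refl
  sumℚ-map f g (x ∷ xs) = cong (f (g x) +_) (sumℚ-map f g xs)

  sumℚ-upTo-suc : (f : ℕ → ℚ) → ∀ E → sumℚ f (upTo (suc E)) ≡ sumℚ f (upTo E) + f E
  sumℚ-upTo-suc f E = trans (cong (sumℚ f) (sym (upTo-∷ʳ E))) (sumℚ-snoc f (upTo E) E)

  sumTo≡sumℚ-range1 : ∀ f M → sumTo f M ≡ sumℚ f (range1 M)
  sumTo≡sumℚ-range1 f zero = refl
  sumTo≡sumℚ-range1 f (suc M) = begin
    sumTo f M + f (suc M)              ≡⟨ cong (_+ f (suc M)) (sumTo≡sumℚ-range1 f M) ⟩
    sumℚ f (range1 M) + f (suc M)      ≡⟨ sym (sumℚ-snoc f (range1 M) (suc M)) ⟩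
    sumℚ f (range1 M ++ [ suc M ])     ≡⟨ cong (sumℚ f) (sym (range1-suc M)) ⟩
    sumℚ f (range1 (suc M))            ∎
    where open ≡-Reasoning

module FiniteProducts where

  open RationalArithmetic
  open FiniteSums
  open import Data.Nat as ℕ using (ℕ; zero; suc)
  open import Data.Rational using (ℚ; 0ℚ; 1ℚ; _+_; _*_; _-_; -_; _≤_; *<*)
  open import Data.Rational.Properties
  import Data.Integer as ℤ
  open import Data.List using (upTo)
  open import Relation.Binary.PropositionalEquality
  open import Data.Rational.Solver using (module +-*-Solver)
  open +-*-Solver using (solve; _:+_; _:*_; _:-_; _:=_; con)

  prodℚ : (ℕ → ℚ) → ℕ → ℚ
  prodℚ g zero = 1ℚ
  prodℚ g (suc j) = g j * prodℚ g j

  prodℚ-cong : ∀ {g g'} → (∀ i → g i ≡ g' i) → ∀ N → prodℚ g N ≡ prodℚ g' N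
  prodℚ-cong g≡g' zero = refl
  prodℚ-cong g≡g' (suc N) = cong₂ _*_ (g≡g' N) (prodℚ-cong g≡g' N)

  prodℚ-0≤ : ∀ {g} → (∀ i → 0ℚ ≤ g i) → ∀ N → 0ℚ ≤ prodℚ g N
  prodℚ-0≤ g≥0 zero = <⇒≤ (*<* (ℤ.+<+ (ℕ.s≤s ℕ.z≤n)))
  prodℚ-0≤ g≥0 (suc N) = *-0≤ (g≥0 N) (prodℚ-0≤ g≥0 N)

  prodℚ-mono-≤ : ∀ {g g'} → (∀ i → 0ℚ ≤ g i) → (∀ i → g i ≤ g' i) → ∀ N → prodℚ g N ≤ prodℚ g' N
  prodℚ-mono-≤ g≥0 g≤g' zero = ≤-refl
  prodℚ-mono-≤ g≥0 g≤g' (suc N) = *-mono-≤-0≤ (g≥0 N) (prodℚ-0≤ g≥0 N) (g≤g' N) (prodℚ-mono-≤ g≥0 g≤g' N)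

  prodℚ-* : ∀ a b N → prodℚ (λ j → a j * b j) N ≡ prodℚ a N * prodℚ b N
  prodℚ-* a b zero = refl
  prodℚ-* a b (suc N) = trans (cong (a N * b N *_) (prodℚ-* a b N))
    (solve 4 (λ x y X Y → x :* y :* (X :* Y) := x :* X :* (y :* Y)) refl (a N) (b N) (prodℚ a N) (prodℚ b N))

  1-sum≤prod[1-] : ∀ w → (∀ i → 0ℚ ≤ w i) → (∀ i → w i ≤ 1ℚ) → ∀ N → 1ℚ - sumℚ w (upTo N) ≤ prodℚ (λ j → 1ℚ - w j) N
  1-sum≤prod[1-] w w≥0 w≤1 zero = ≤-refl
  1-sum≤prod[1-] w w≥0 w≤1 (suc N) = begin
    1ℚ - sumℚ w (upTo (suc N))        ≡⟨ cong (λ t → 1ℚ - t) (sumℚ-upTo-suc w N) ⟩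
    1ℚ - (s + a)                      ≤⟨ 1-[s+a]≤[1-a]*[1-s] ⟩
    (1ℚ - a) * (1ℚ - s)               ≤⟨ *-monoʳ-≤-0≤ 0≤1-a (1-sum≤prod[1-] w w≥0 w≤1 N) ⟩
    (1ℚ - a) * prodℚ (λ j → 1ℚ - w j) N ∎
    where
    open ≤-Reasoning
    s a : ℚ
    s = sumℚ w (upTo N)
    a = w N
    1-[s+a]≤[1-a]*[1-s] : 1ℚ - (s + a) ≤ (1ℚ - a) * (1ℚ - s)
    1-[s+a]≤[1-a]*[1-s] = subst₂ _≤_
      (solve 2 (λ a s → con 1ℚ :- a :- s :+ con 0ℚ := con 1ℚ :- (s :+ a)) refl a s)
      (solve 2 (λ a s → con 1ℚ :- a :- s :+ a :* s := (con 1ℚ :- a) :* (con 1ℚ :- s)) refl a s)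
      (+-monoʳ-≤ (1ℚ - a - s) (*-0≤ (w≥0 N) (sumℚ-0≤ w w≥0 (upTo N))))
    0≤1-a : 0ℚ ≤ 1ℚ - a
    0≤1-a = subst (_≤ 1ℚ - a) (+-inverseʳ a) (+-monoˡ-≤ (- a) (w≤1 N))

  sumℚ-upTo≤ : ∀ w c → (∀ i → w i ≤ c) → ∀ N → sumℚ w (upTo N) ≤ fromℕ N * c
  sumℚ-upTo≤ w c w≤c zero = ≤-reflexive (sym (*-zeroˡ c))
  sumℚ-upTo≤ w c w≤c (suc N) = begin
    sumℚ w (upTo (suc N))          ≡⟨ sumℚ-upTo-suc w N ⟩
    sumℚ w (upTo N) + w N          ≤⟨ +-mono-≤ (sumℚ-upTo≤ w c w≤c N) (w≤c N) ⟩
    fromℕ N * c + c                ≡⟨ solve 2 (λ n c → n :* c :+ c := (con 1ℚ :+ n) :* c) refl (fromℕ N) c ⟩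
    (1ℚ + fromℕ N) * c             ≡⟨ cong (_* c) (fromℕ-+ 1 N) ⟩
    fromℕ (suc N) * c              ∎
    where open ≤-Reasoning

module ExponentBoxes where

  open FiniteSums
  open FiniteProducts
  open import Data.Nat as ℕ using (ℕ; zero; suc)
  open import Data.Rational using (ℚ; 1ℚ; _+_; _*_)
  open import Data.Rational.Properties using (+-identityʳ; *-zeroˡ; *-distribʳ-+)
  open import Data.Vec using (Vec; []; _∷_)
  import Data.Vec.Properties as Vec
  open import Data.Vec.Relation.Unary.All using (All; []; _∷_)
  open import Data.List using (List; []; _∷_; _++_; map; upTo; cartesianProductWith)
  open import Data.List.Membership.Propositional using (_∈_)
  open import Data.List.Membership.Propositional.Properties using (∈-cartesianProductWith⁺; ∈-cartesianProductWith⁻; ∈-upTo⁺; ∈-upTo⁻)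
  open import Data.List.Relation.Unary.Any using (here)
  import Data.List.Relation.Unary.All as List
  open import Data.List.Relation.Unary.Unique.Propositional using (Unique)
  open import Data.List.Relation.Unary.Unique.Propositional.Properties using (cartesianProductWith⁺; upTo⁺)
  open import Data.List.Relation.Unary.AllPairs using ([]; _∷_)
  open import Data.Product using (_,_)
  open import Relation.Binary.PropositionalEquality hiding ([_])

  box : ℕ → (j : ℕ) → List (Vec ℕ j)
  box E zero = [] ∷ []
  box E (suc j) = cartesianProductWith _∷_ (upTo E) (box E j)

  box-unique : ∀ E j → Unique (box E j)
  box-unique E zero = List.[] ∷ []
  box-unique E (suc j) = cartesianProductWith⁺ _∷_ Vec.∷-injective (upTo⁺ E) (box-unique E j)

  box⁺ : ∀ E {j} (v : Vec ℕ j) → All (ℕ._< E) v → v ∈ box E j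
  box⁺ E [] [] = here refl
  box⁺ E (e ∷ v) (e<E ∷ v<E) = ∈-cartesianProductWith⁺ _∷_ (∈-upTo⁺ e<E) (box⁺ E v v<E)

  box⁻ : ∀ E {j} (v : Vec ℕ j) → v ∈ box E j → All (ℕ._< E) v
  box⁻ E [] _ = []
  box⁻ E {suc j} (e ∷ v) e∷v∈ with ∈-cartesianProductWith⁻ _∷_ (upTo E) (box E j) e∷v∈
  ... | _ , _ , e∈ , v∈ , refl = ∈-upTo⁻ e∈ ∷ box⁻ E v v∈

  prodℚᵥ : (ℕ → ℕ → ℚ) → ∀ {j} → Vec ℕ j → ℚ
  prodℚᵥ h [] = 1ℚ
  prodℚᵥ h {suc j} (e ∷ v) = h j e * prodℚᵥ h v

  sumℚ-cartesianProduct : (h : ℕ → ℕ → ℚ) → ∀ j xs (vs : List (Vec ℕ j)) →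
    sumℚ (prodℚᵥ h) (cartesianProductWith _∷_ xs vs) ≡ sumℚ (h j) xs * sumℚ (prodℚᵥ h) vs
  sumℚ-cartesianProduct h j [] vs = sym (*-zeroˡ (sumℚ (prodℚᵥ h) vs))
  sumℚ-cartesianProduct h j (x ∷ xs) vs = begin
    sumℚ (prodℚᵥ h) (map (x ∷_) vs ++ cartesianProductWith _∷_ xs vs)
      ≡⟨ sumℚ-++ (prodℚᵥ h) (map (x ∷_) vs) _ ⟩
    sumℚ (prodℚᵥ h) (map (x ∷_) vs) + sumℚ (prodℚᵥ h) (cartesianProductWith _∷_ xs vs)
      ≡⟨ cong₂ _+_ (trans (sumℚ-map (prodℚᵥ h) (x ∷_) vs) (sumℚ-*ˡ (prodℚᵥ h) (h j x) vs)) (sumℚ-cartesianProduct h j xs vs) ⟩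
    h j x * sumℚ (prodℚᵥ h) vs + sumℚ (h j) xs * sumℚ (prodℚᵥ h) vs
      ≡⟨ sym (*-distribʳ-+ (sumℚ (prodℚᵥ h) vs) (h j x) (sumℚ (h j) xs)) ⟩
    (h j x + sumℚ (h j) xs) * sumℚ (prodℚᵥ h) vs
      ∎
    where open ≡-Reasoning

  sumℚ-box : (h : ℕ → ℕ → ℚ) → ∀ E j → sumℚ (prodℚᵥ h) (box E j) ≡ prodℚ (λ i → sumℚ (h i) (upTo E)) j
  sumℚ-box h E zero = +-identityʳ 1ℚ
  sumℚ-box h E (suc j) = trans (sumℚ-cartesianProduct h j (upTo E) (box E j)) (cong (sumℚ (h j) (upTo E) *_) (sumℚ-box h E j))

module SeriesTerms (p : ℕ → ℕ) (N : ℕ) where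

  open RationalArithmetic using (inv-nonNeg)
  open import Defs
  open import Data.Nat using (zero; suc; _*_; _∸_; NonZero)
  open import Data.Rational using (0ℚ; _≤_)
  open import Data.Rational.Properties using (≤-refl)
  open import Data.Product using (_×_; _,_)
  open import Relation.Nullary using (yes; no; contradiction)
  open import Relation.Binary.PropositionalEquality

  lhsTerm-0≤ : ∀ k n → 0ℚ ≤ lhsTerm p N k n
  lhsTerm-0≤ k zero = ≤-refl
  lhsTerm-0≤ k (suc n) with free? k (suc n) | smooth? p N n
  ... | yes _ | yes _ = inv-nonNeg (freePart (k ∸ 1) (suc n) * φ (powerPart (k ∸ 1) (suc n)))
  ... | yes _ | no _ = ≤-refl
  ... | no _ | _ = ≤-refl

  rhsTerm-0≤ : ∀ n → 0ℚ ≤ rhsTerm p N n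
  rhsTerm-0≤ zero = ≤-refl
  rhsTerm-0≤ (suc n) with smooth? p N n
  ... | yes _ = inv-nonNeg (suc n)
  ... | no _ = ≤-refl

  lhsTerm≢0⇒free×smooth : ∀ k n → lhsTerm p N k n ≢ 0ℚ → Free k n × Smooth p N n
  lhsTerm≢0⇒free×smooth k zero ≢0 = contradiction refl ≢0
  lhsTerm≢0⇒free×smooth k (suc n) ≢0 with free? k (suc n) | smooth? p N n
  ... | yes free | yes smooth = free , smooth
  ... | yes _ | no _ = contradiction refl ≢0
  ... | no _ | _ = contradiction refl ≢0

  rhsTerm≢0⇒smooth : ∀ n → rhsTerm p N n ≢ 0ℚ → Smooth p N n
  rhsTerm≢0⇒smooth zero ≢0 = contradiction refl ≢0
  rhsTerm≢0⇒smooth (suc n) ≢0 with smooth? p N n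
  ... | yes smooth = smooth
  ... | no _ = contradiction refl ≢0

  lhsTerm-accept : ∀ k n → .{{NonZero n}} → Free k n → Smooth p N n →
                   lhsTerm p N k n ≡ inv (freePart (k ∸ 1) n * φ (powerPart (k ∸ 1) n))
  lhsTerm-accept k (suc n) free smooth with free? k (suc n) | smooth? p N n
  ... | yes _ | yes _ = refl
  ... | yes _ | no ¬smooth = contradiction smooth ¬smooth
  ... | no ¬free | _ = contradiction free ¬free

  rhsTerm-accept : ∀ n → .{{NonZero n}} → Smooth p N n → rhsTerm p N n ≡ inv n
  rhsTerm-accept (suc n) smooth with smooth? p N n
  ... | yes _ = refl
  ... | no ¬smooth = contradiction smooth ¬smooth

module EulerFactors (p : ℕ → ℕ) (p-prime : ∀ i → Prime (p i)) (p-increasing : ∀ i → p i ℕ.< p (suc i)) where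

  open ExponentVectors p p-prime p-increasing
  open RationalArithmetic
  open FiniteSums
  open ExponentBoxes using (prodℚᵥ)
  open import Defs using (inv; rhsTerm; lhsTerm; φ; freePart; powerPart)
  open SeriesTerms using (rhsTerm-accept; lhsTerm-accept)
  open import Data.Nat as ℕ using (ℕ; zero; suc; _^_; _∸_)
  import Data.Nat.Properties as ℕ
  open import Data.Rational using (ℚ; 0ℚ; 1ℚ; _+_; _*_; _-_; _≤_)
  open import Data.Rational.Properties
  open import Data.List using (upTo)
  open import Data.List.Membership.Propositional using (_∈_)
  open import Data.List.Membership.Propositional.Properties using (∈-upTo⁻)
  open import Data.Vec.Relation.Unary.All using (All)
  open import Data.Vec using (Vec; []; _∷_)
  open import Relation.Binary.PropositionalEquality
  open import Data.Rational.Solver using (module +-*-Solver)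
  open +-*-Solver using (solve; _:+_; _:*_; _:-_; _:=_; con)

  x y z : ℕ → ℚ
  x j = inv (p j)
  y j = inv (p j ∸ 1)
  z j = fromℕ (p j) * y j

  x*z≡y : ∀ j → x j * z j ≡ y j
  x*z≡y j = begin
    x j * (fromℕ (p j) * y j)    ≡⟨ sym (*-assoc (x j) (fromℕ (p j)) (y j)) ⟩
    x j * fromℕ (p j) * y j      ≡⟨ cong (_* y j) (inv-inverseˡ (p j)) ⟩
    1ℚ * y j                     ≡⟨ *-identityˡ (y j) ⟩
    y j                          ∎
    where open ≡-Reasoning

  1+y≡z : ∀ j → 1ℚ + y j ≡ z j
  1+y≡z j = begin
    1ℚ + y j                              ≡⟨ cong (_+ y j) (sym (inv-inverseˡ (p j ∸ 1))) ⟩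
    y j * fromℕ (p j ∸ 1) + y j           ≡⟨ solve 2 (λ y n → y :* n :+ y := (con 1ℚ :+ n) :* y) refl (y j) (fromℕ (p j ∸ 1)) ⟩
    (1ℚ + fromℕ (p j ∸ 1)) * y j          ≡⟨ cong (_* y j) (fromℕ-+ 1 (p j ∸ 1)) ⟩
    fromℕ (1 ℕ.+ (p j ∸ 1)) * y j         ≡⟨ cong (λ n → fromℕ n * y j) (ℕ.m+[n∸m]≡n (ℕ.>-nonZero⁻¹ (p j))) ⟩
    z j                                   ∎
    where open ≡-Reasoning

  x-0≤ : ∀ j → 0ℚ ≤ x j
  x-0≤ j = inv-nonNeg (p j)

  z-0≤ : ∀ j → 0ℚ ≤ z j
  z-0≤ j = *-0≤ (fromℕ-nonNeg (p j)) (inv-nonNeg (p j ∸ 1))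

  z≤p : ∀ j → z j ≤ fromℕ (p j)
  z≤p j = subst (z j ≤_) (*-identityʳ (fromℕ (p j))) (*-monoʳ-≤-0≤ (fromℕ-nonNeg (p j)) (inv≤1 (p j ∸ 1)))

  geometricSum : ℕ → ℕ → ℚ
  geometricSum j E = sumℚ (x j ^ℚ_) (upTo E)

  geometricSum+tail : ∀ j E → geometricSum j E + x j ^ℚ E * z j ≡ z j
  geometricSum+tail j zero = trans (+-identityˡ _) (*-identityˡ (z j))
  geometricSum+tail j (suc E) = begin
    geometricSum j (suc E) + x j * x j ^ℚ E * z j          ≡⟨ cong (_+ x j * x j ^ℚ E * z j) (sumℚ-upTo-suc (x j ^ℚ_) E) ⟩
    geometricSum j E + x j ^ℚ E + x j * x j ^ℚ E * z j     ≡⟨ solve 4 (λ S w x z → S :+ w :+ x :* w :* z := S :+ w :* (con 1ℚ :+ x :* z)) refl (geometricSum j E) (x j ^ℚ E) (x j) (z j) ⟩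
    geometricSum j E + x j ^ℚ E * (1ℚ + x j * z j)         ≡⟨ cong (λ t → geometricSum j E + x j ^ℚ E * (1ℚ + t)) (x*z≡y j) ⟩
    geometricSum j E + x j ^ℚ E * (1ℚ + y j)               ≡⟨ cong (λ t → geometricSum j E + x j ^ℚ E * t) (1+y≡z j) ⟩
    geometricSum j E + x j ^ℚ E * z j                      ≡⟨ geometricSum+tail j E ⟩
    z j                                                    ∎
    where open ≡-Reasoning

  geometricSum≡ : ∀ j E → geometricSum j E ≡ z j * (1ℚ - x j ^ℚ E)
  geometricSum≡ j E = begin
    geometricSum j E                                    ≡⟨ solve 2 (λ S t → S := S :+ t :- t) refl (geometricSum j E) (x j ^ℚ E * z j) ⟩
    geometricSum j E + x j ^ℚ E * z j - x j ^ℚ E * z j  ≡⟨ cong (_- x j ^ℚ E * z j) (geometricSum+tail j E) ⟩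
    z j - x j ^ℚ E * z j                                ≡⟨ solve 2 (λ z w → z :- w :* z := z :* (con 1ℚ :- w)) refl (z j) (x j ^ℚ E) ⟩
    z j * (1ℚ - x j ^ℚ E)                               ∎
    where open ≡-Reasoning

  geometricSum≤z : ∀ j E → geometricSum j E ≤ z j
  geometricSum≤z j E = subst₂ _≤_ (+-identityʳ (geometricSum j E)) (geometricSum+tail j E)
    (+-monoʳ-≤ (geometricSum j E) (*-0≤ (^ℚ-0≤ (x-0≤ j) E) (z-0≤ j)))

  inv-⟦⟧ : ∀ {j} (v : Vec ℕ j) → inv ⟦ v ⟧ ≡ prodℚᵥ (λ i → x i ^ℚ_) v
  inv-⟦⟧ [] = refl
  inv-⟦⟧ {suc j} (e ∷ v) = trans (inv-* (p j ^ e) ⟦ v ⟧ {{ℕ.m^n≢0 (p j) e}} {{⟦⟧-nonZero v}})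
                                 (cong₂ _*_ (inv-^ (p j) e) (inv-⟦⟧ v))

  rhsTerm-⟦⟧ : ∀ N (v : Vec ℕ N) → rhsTerm p N ⟦ v ⟧ ≡ prodℚᵥ (λ i → x i ^ℚ_) v
  rhsTerm-⟦⟧ N v = trans (rhsTerm-accept p N ⟦ v ⟧ {{⟦⟧-nonZero v}} (⟦⟧-smooth v)) (inv-⟦⟧ v)

  module _ (m₀ : ℕ) where

    open Denominators p p-prime p-increasing m₀

    lhsWeight : ℕ → ℕ → ℚ
    lhsWeight j e = inv (denominator j e)

    lhsWeight-sum : ∀ j → sumℚ (lhsWeight j) (upTo (suc m)) ≡ z j
    lhsWeight-sum j = begin
      sumℚ (lhsWeight j) (upTo (suc m))          ≡⟨ sumℚ-upTo-suc (lhsWeight j) m ⟩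
      sumℚ (lhsWeight j) (upTo m) + lhsWeight j m ≡⟨ cong₂ _+_ (sumℚ-cong (lhsWeight j) (upTo m) weight<m) weight≡m ⟩
      geometricSum j m + x j ^ℚ m * z j           ≡⟨ geometricSum+tail j m ⟩
      z j                                         ∎
      where
      open ≡-Reasoning
      weight<m : ∀ {e} → e ∈ upTo m → lhsWeight j e ≡ x j ^ℚ e
      weight<m {e} e∈ = trans (cong inv (denominator-< j (∈-upTo⁻ e∈))) (inv-^ (p j) e)
      weight≡m : lhsWeight j m ≡ x j ^ℚ m * z j
      weight≡m = begin
        inv (denominator j m)                ≡⟨ cong inv (denominator-m j) ⟩
        inv (p j ^ m₀ ℕ.* (p j ∸ 1))         ≡⟨ inv-* (p j ^ m₀) (p j ∸ 1) {{ℕ.m^n≢0 (p j) m₀}} ⟩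
        inv (p j ^ m₀) * y j                 ≡⟨ cong₂ _*_ (inv-^ (p j) m₀) (sym (x*z≡y j)) ⟩
        x j ^ℚ m₀ * (x j * z j)              ≡⟨ solve 3 (λ a b c → a :* (b :* c) := b :* a :* c) refl (x j ^ℚ m₀) (x j) (z j) ⟩
        x j ^ℚ m * z j                       ∎

    inv-denominatorOf : ∀ {j} (v : Vec ℕ j) → inv (denominatorOf v) ≡ prodℚᵥ lhsWeight v
    inv-denominatorOf [] = refl
    inv-denominatorOf {suc j} (e ∷ v) =
      trans (inv-* (denominator j e) (denominatorOf v) {{denominator-nonZero j e}} {{denominatorOf-nonZero v}})
            (cong (lhsWeight j e *_) (inv-denominatorOf v))

    lhsTerm-⟦⟧ : ∀ N (v : Vec ℕ N) → All (ℕ._< suc m) v → lhsTerm p N (suc m) ⟦ v ⟧ ≡ prodℚᵥ lhsWeight v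
    lhsTerm-⟦⟧ N v v≤m = begin
      lhsTerm p N (suc m) ⟦ v ⟧                         ≡⟨ lhsTerm-accept p N (suc m) ⟦ v ⟧ {{⟦⟧-nonZero v}} (exponents<⇒free m v v≤m) (⟦⟧-smooth v) ⟩
      inv (freePart m ⟦ v ⟧ ℕ.* φ (powerPart m ⟦ v ⟧))   ≡⟨ cong inv (freePart*φ[powerPart]-⟦⟧ v v≤m) ⟩
      inv (denominatorOf v)                             ≡⟨ inv-denominatorOf v ⟩
      prodℚᵥ lhsWeight v                                ∎
      where open ≡-Reasoning

module Convergence (p : ℕ → ℕ) (p-prime : ∀ i → Prime (p i)) (p-increasing : ∀ i → p i ℕ.< p (suc i)) (N : ℕ) where

  open Arithmetic using (prime⇒2≤; n<2^n)
  open ExponentVectors p p-prime p-increasing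
  open RationalArithmetic
  open FiniteSums
  open FiniteProducts
  open ExponentBoxes
  open SeriesTerms p N
  open EulerFactors p p-prime p-increasing
  open RangeLists
  open import Defs
  open import Data.Nat as ℕ using (ℕ; zero; suc; _^_)
  import Data.Nat.Properties as ℕ
  open import Data.Rational using (ℚ; 0ℚ; 1ℚ; _*_; _-_; _≤_; _<_; ∣_∣)
  open import Data.Rational.Properties
  open import Data.List using (List; map; upTo)
  open import Data.List.Membership.Propositional using (_∈_)
  open import Data.List.Membership.Propositional.Properties using (∈-map⁺; ∈-map⁻)
  open import Data.List.Relation.Unary.Unique.Propositional.Properties using (map⁺)
  open import Data.Vec using (Vec; []; _∷_; replicate)
  open import Data.Vec.Relation.Unary.All using (All; []; _∷_)
  open import Data.Product using (_,_; proj₁; proj₂)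
  open import Relation.Binary.PropositionalEquality
  open import Function using (_∘_)
  open import Data.Rational.Solver using (module +-*-Solver)
  open +-*-Solver using (solve; _:*_; _:-_; _:=_; con)

  smoothBox : ℕ → List ℕ
  smoothBox E = map ⟦_⟧ (box E N)

  boxBound : ℕ → ℕ
  boxBound E = ⟦ replicate N E ⟧

  ⟦⟧≤boxBound : ∀ E {j} (v : Vec ℕ j) → All (ℕ._< E) v → ⟦ v ⟧ ℕ.≤ ⟦ replicate j E ⟧
  ⟦⟧≤boxBound E [] [] = ℕ.≤-refl
  ⟦⟧≤boxBound E {suc j} (e ∷ v) (e<E ∷ v<E) = ℕ.*-mono-≤ (ℕ.^-monoʳ-≤ (p j) (ℕ.<⇒≤ e<E)) (⟦⟧≤boxBound E v v<E)

  sumℚ-smoothBox : (f : ℕ → ℚ) (h : ℕ → ℕ → ℚ) → ∀ E → (∀ v → All (ℕ._< E) v → f ⟦ v ⟧ ≡ prodℚᵥ h v) →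
                   sumℚ f (smoothBox E) ≡ prodℚ (λ i → sumℚ (h i) (upTo E)) N
  sumℚ-smoothBox f h E f≡h = begin
    sumℚ f (map ⟦_⟧ (box E N))                   ≡⟨ sumℚ-map f ⟦_⟧ (box E N) ⟩
    sumℚ (λ v → f ⟦ v ⟧) (box E N)               ≡⟨ sumℚ-cong _ (box E N) (λ {v} v∈ → f≡h v (box⁻ E v v∈)) ⟩
    sumℚ (prodℚᵥ h) (box E N)                    ≡⟨ sumℚ-box h E N ⟩
    prodℚ (λ i → sumℚ (h i) (upTo E)) N          ∎
    where open ≡-Reasoning

  sumℚ-smoothBox≤range1 : ∀ f → (∀ n → 0ℚ ≤ f n) → ∀ E M → boxBound E ℕ.≤ M → sumℚ f (smoothBox E) ≤ sumℚ f (range1 M)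
  sumℚ-smoothBox≤range1 f f≥0 E M bound≤M =
    sumℚ-mono-⊆ f f≥0 (smoothBox E) (range1 M) (map⁺ (⟦⟧-injective _ _) (box-unique E N)) (λ n∈ _ → inRange n∈)
    where
    inRange : ∀ {n} → n ∈ smoothBox E → n ∈ range1 M
    inRange n∈ with ∈-map⁻ ⟦_⟧ n∈
    ... | v , v∈ , refl = range1⁺ (ℕ.>-nonZero⁻¹ _ {{⟦⟧-nonZero v}}) (ℕ.≤-trans (⟦⟧≤boxBound E v (box⁻ E v v∈)) bound≤M)

  sumℚ-range1≤smoothBox : ∀ f → (∀ n → 0ℚ ≤ f n) → (∀ n → f n ≢ 0ℚ → Smooth p N n) → ∀ E M →
                          (∀ v → ⟦ v ⟧ ℕ.≤ M → f ⟦ v ⟧ ≢ 0ℚ → All (ℕ._< E) v) →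
                          sumℚ f (range1 M) ≤ sumℚ f (smoothBox E)
  sumℚ-range1≤smoothBox f f≥0 support E M exponents< = sumℚ-mono-⊆ f f≥0 (range1 M) (smoothBox E) (range1-unique M) inBox
    where
    inBox : ∀ {n} → n ∈ range1 M → f n ≢ 0ℚ → n ∈ smoothBox E
    inBox {n} n∈ fn≢0 with range1⁻ n∈ | smooth⇒∃⟦⟧ N n (proj₁ (range1⁻ n∈)) (support n fn≢0)
    ... | _ , n≤M | v , refl = ∈-map⁺ ⟦_⟧ (box⁺ E v (exponents< v n≤M fn≢0))

  L : ℚ
  L = prodℚ z N

  module LeftHandSide (m₀ : ℕ) where

    k : ℕ
    k = suc (suc m₀)

    sumℚ-lhsTerm-smoothBox : sumℚ (lhsTerm p N k) (smoothBox k) ≡ L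
    sumℚ-lhsTerm-smoothBox = trans (sumℚ-smoothBox (lhsTerm p N k) (lhsWeight m₀) k (lhsTerm-⟦⟧ m₀ N))
                                   (prodℚ-cong (lhsWeight-sum m₀) N)

    lhsPartial-eventually : ∀ M → boxBound k ℕ.≤ M → lhsPartial p N k M ≡ L
    lhsPartial-eventually M bound≤M = trans (sumTo≡sumℚ-range1 (lhsTerm p N k) M) (≤-antisym range1≤L L≤range1)
      where
      range1≤L : sumℚ (lhsTerm p N k) (range1 M) ≤ L
      range1≤L = subst (sumℚ (lhsTerm p N k) (range1 M) ≤_) sumℚ-lhsTerm-smoothBox
        (sumℚ-range1≤smoothBox (lhsTerm p N k) (lhsTerm-0≤ k) (λ n → proj₂ ∘ lhsTerm≢0⇒free×smooth k n) k M
          (λ v _ ≢0 → free⇒exponents< k v (proj₁ (lhsTerm≢0⇒free×smooth k ⟦ v ⟧ ≢0))))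
      L≤range1 : L ≤ sumℚ (lhsTerm p N k) (range1 M)
      L≤range1 = subst (_≤ sumℚ (lhsTerm p N k) (range1 M)) sumℚ-lhsTerm-smoothBox
        (sumℚ-smoothBox≤range1 (lhsTerm p N k) (lhsTerm-0≤ k) k M bound≤M)

    lhsPartial-converges : ConvergesTo (lhsPartial p N k) L
    lhsPartial-converges ε 0<ε = boxBound k , λ M bound≤M →
      subst (_< ε) (sym (cong ∣_∣ (trans (cong (_- L) (lhsPartial-eventually M bound≤M)) (+-inverseʳ L)))) 0<ε

  boxSum : ℕ → ℚ
  boxSum E = prodℚ (λ j → geometricSum j E) N

  sumℚ-rhsTerm-smoothBox : ∀ E → sumℚ (rhsTerm p N) (smoothBox E) ≡ boxSum E
  sumℚ-rhsTerm-smoothBox E = sumℚ-smoothBox (rhsTerm p N) (λ i → x i ^ℚ_) E (λ v _ → rhsTerm-⟦⟧ N v)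

  rhsPartial≤L : ∀ M → rhsPartial p N M ≤ L
  rhsPartial≤L M = begin
    rhsPartial p N M                    ≡⟨ sumTo≡sumℚ-range1 (rhsTerm p N) M ⟩
    sumℚ (rhsTerm p N) (range1 M)       ≤⟨ sumℚ-range1≤smoothBox (rhsTerm p N) rhsTerm-0≤ rhsTerm≢0⇒smooth M M (λ v ⟦v⟧≤M _ → ⟦⟧≤⇒exponents< M v ⟦v⟧≤M) ⟩
    sumℚ (rhsTerm p N) (smoothBox M)    ≡⟨ sumℚ-rhsTerm-smoothBox M ⟩
    boxSum M                            ≤⟨ prodℚ-mono-≤ (λ j → sumℚ-0≤ _ (^ℚ-0≤ (x-0≤ j)) (upTo M)) (λ j → geometricSum≤z j M) N ⟩
    L                                   ∎
    where open ≤-Reasoning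

  boxSum≤rhsPartial : ∀ E M → boxBound E ℕ.≤ M → boxSum E ≤ rhsPartial p N M
  boxSum≤rhsPartial E M bound≤M = subst₂ _≤_ (sumℚ-rhsTerm-smoothBox E) (sym (sumTo≡sumℚ-range1 (rhsTerm p N) M))
    (sumℚ-smoothBox≤range1 (rhsTerm p N) rhsTerm-0≤ E M bound≤M)

  primorial : ℕ → ℕ
  primorial zero = 1
  primorial (suc j) = p j ℕ.* primorial j

  L≤primorial : L ≤ fromℕ (primorial N)
  L≤primorial = subst (L ≤_) (prodℚ-fromℕ N) (prodℚ-mono-≤ z-0≤ z≤p N)
    where
    prodℚ-fromℕ : ∀ N → prodℚ (λ j → fromℕ (p j)) N ≡ fromℕ (primorial N)
    prodℚ-fromℕ zero = refl
    prodℚ-fromℕ (suc N) = trans (cong (fromℕ (p N) *_) (prodℚ-fromℕ N)) (fromℕ-* (p N) (primorial N))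

  -- L - boxSum E = L (1 - ∏ (1 - x j ^ E)) ≤ L Σ x j ^ E, and x j ^ E ≤ 2 ^ -E.
  L-boxSum≤ : ∀ E → L - boxSum E ≤ fromℕ (primorial N ℕ.* N) * inv (2 ^ E)
  L-boxSum≤ E = begin
    L - boxSum E                                   ≡⟨ cong (L -_) (trans (prodℚ-cong (λ j → geometricSum≡ j E) N) (prodℚ-* z (λ j → 1ℚ - w j) N)) ⟩
    L - L * W                                      ≡⟨ solve 2 (λ L W → L :- L :* W := L :* (con 1ℚ :- W)) refl L W ⟩
    L * (1ℚ - W)                                   ≤⟨ *-monoʳ-≤-0≤ (prodℚ-0≤ z-0≤ N) 1-W≤Σw ⟩
    L * sumℚ w (upTo N)                            ≤⟨ *-mono-≤-0≤ (prodℚ-0≤ z-0≤ N) (sumℚ-0≤ w w-0≤ (upTo N)) L≤primorial Σw≤ ⟩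
    fromℕ (primorial N) * (fromℕ N * inv (2 ^ E))  ≡⟨ sym (*-assoc (fromℕ (primorial N)) (fromℕ N) (inv (2 ^ E))) ⟩
    fromℕ (primorial N) * fromℕ N * inv (2 ^ E)    ≡⟨ cong (_* inv (2 ^ E)) (fromℕ-* (primorial N) N) ⟩
    fromℕ (primorial N ℕ.* N) * inv (2 ^ E)        ∎
    where
    open ≤-Reasoning
    w : ℕ → ℚ
    w j = x j ^ℚ E
    W : ℚ
    W = prodℚ (λ j → 1ℚ - w j) N
    w-0≤ : ∀ j → 0ℚ ≤ w j
    w-0≤ j = ^ℚ-0≤ (x-0≤ j) E
    w≤1 : ∀ j → w j ≤ 1ℚ
    w≤1 j = ^ℚ-≤1 (x-0≤ j) (inv≤1 (p j)) E
    w≤2^-E : ∀ j → w j ≤ inv (2 ^ E)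
    w≤2^-E j = subst (_≤ inv (2 ^ E)) (inv-^ (p j) E) (inv-antimono-≤ {{ℕ.m^n≢0 2 E}} (ℕ.^-monoˡ-≤ E (prime⇒2≤ (p-prime j))))
    1-W≤Σw : 1ℚ - W ≤ sumℚ w (upTo N)
    1-W≤Σw = 1-≤-swap W (sumℚ w (upTo N)) (1-sum≤prod[1-] w w-0≤ w≤1 N)
    Σw≤ : sumℚ w (upTo N) ≤ fromℕ N * inv (2 ^ E)
    Σw≤ = sumℚ-upTo≤ w (inv (2 ^ E)) w≤2^-E N

  rhsPartial-converges : ConvergesTo (rhsPartial p N) L
  rhsPartial-converges ε 0<ε with ∃inv≤ ε 0<ε
  ... | b , inv[1+b]≤ε = boxBound E , λ M bound≤M → begin-strict
    ∣ rhsPartial p N M - L ∣                     ≤⟨ ∣-∣≤-between (boxSum≤rhsPartial E M bound≤M) (rhsPartial≤L M) ⟩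
    L - boxSum E                                 ≤⟨ L-boxSum≤ E ⟩
    fromℕ (primorial N ℕ.* N) * inv (2 ^ E)      <⟨ fromℕ*inv<inv (primorial N ℕ.* N) (suc b) (2 ^ E) {{_}} {{ℕ.m^n≢0 2 E}} (n<2^n E) ⟩
    inv (suc b)                                  ≤⟨ inv[1+b]≤ε ⟩
    ε                                            ∎
    where
    open ≤-Reasoning
    E : ℕ
    E = primorial N ℕ.* N ℕ.* suc b

open import Defs
open import Data.Nat using (_<_; _≤_; s≤s)
open import Data.Product using (_×_; ∃-syntax; _,_)

theorem2 : (p : ℕ → ℕ) → (∀ i → Prime (p i)) → (∀ i → p i < p (suc i))
    → (N : ℕ) → 1 ≤ N → (k : ℕ) → 2 ≤ k
    → ∃[ L ] (ConvergesTo (lhsPartial p N k) L × ConvergesTo (rhsPartial p N) L)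
theorem2 p p-prime p-increasing N _ (suc (suc m₀)) (s≤s (s≤s _)) =
  L , lhsPartial-converges , rhsPartial-converges
  where
  open Convergence p p-prime p-increasing N
  open LeftHandSide m₀
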